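{- Let $n$ be even and let $G$ be a subcubic graph of order $n$ containing a consecutive permutation $2$-factor $F$ with cycles $C_1$ and $C_2$. Let $u,v$ be non-adjacent vertices of $G$ such that $\{u,v\}$ is an eligible pair with respect to $F$, and let $e=uv$. If the set $N_{G+e}(u)\cup N_{G+e}(v)$ contains at least two vertices of degree $2$ in $G+e$, then every consecutive permutation $2$-factor of $G+e$ is also a consecutive permutation $2$-factor of $G$.
   Context: All graphs are simple. A graph is subcubic if every vertex has degree at most $3$. For a graph $H$ and vertex $x$, $N_H(x)$ denotes the set of neighbours of $x$ in $H$, and $H+e$ denotes the graph obtained by adding the edge $e$. For a subcubic graph $H$ of even order $n$, a permutation $2$-factor of $H$ is a $2$-factor of $H$ consisting of two cycles $C_1,C_2$, each of length $n/2$ and each chordless (i.e. induced) in $H$. A permutation $2$-factor with cycles $C_1,C_2$ is consecutive if the vertices of degree $3$ (in $H$) lying on $C_1$ induce a path or a cycle, or the vertices of degree $3$ lying on $C_2$ induce a path or a cycle. For a consecutive permutation $2$-factor with cycles $C_1,C_2$ and $i\in\{1,2\}$: if the degree-$3$ vertices on $C_i$ induce a path $P$, let $S_i$ be the set of degree-$2$ vertices of $C_i$ adjacent (on $C_i$) to $P$; otherwise $S_i=\emptyset$. A pair of vertices is eligible (with respect to this $2$-factor) if one of them lies in some $S_i$ and the other is a vertex of degree $2$ on $C_{3-i}$. -}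

module Defs where

open import Data.Nat using (ℕ; zero; suc; _≤_; _*_)
open import Data.Fin using (Fin; toℕ; _≟_)
open import Data.Bool using (Bool; true; false; T; _∨_; _∧_)
open import Data.List using (List; length; filter; allFin)
open import Data.Product using (Σ; ∃; _×_; _,_)
open import Data.Sum using (_⊎_)
open import Relation.Nullary using (¬_; does)
open import Relation.Nullary.Decidable.Core using (T?)
open import Relation.Binary.PropositionalEquality using (_≡_; _≢_)
open import Function.Definitions using (Injective)

Graph : ℕ → Set
Graph n = Fin n → Fin n → Bool

IsSimple : ∀ {n} → Graph n → Set
IsSimple {n} G = (∀ (x y : Fin n) → G x y ≡ G y x) × (∀ (x : Fin n) → G x x ≡ false)

Adj : ∀ {n} → Graph n → Fin n → Fin n → Set
Adj G x y = T (G x y)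

deg : ∀ {n} → Graph n → Fin n → ℕ
deg {n} G x = length (filter (λ y → T? (G x y)) (allFin n))

Subcubic : ∀ {n} → Graph n → Set
Subcubic G = ∀ x → deg G x ≤ 3

addEdge : ∀ {n} → Graph n → Fin n → Fin n → Graph n
addEdge G u v x y =
  G x y ∨ ((does (x ≟ u) ∧ does (y ≟ v)) ∨ (does (x ≟ v) ∧ does (y ≟ u)))

CycSucc : (k : ℕ) → Fin k → Fin k → Set
CycSucc k i j = (suc (toℕ i) ≡ toℕ j) ⊎ ((suc (toℕ i) ≡ k) × (toℕ j ≡ 0))

CycAdj : (k : ℕ) → Fin k → Fin k → Set
CycAdj k i j = CycSucc k i j ⊎ CycSucc k j i

PathAdj : (l : ℕ) → Fin l → Fin l → Set
PathAdj l i j = (suc (toℕ i) ≡ toℕ j) ⊎ (suc (toℕ j) ≡ toℕ i)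

record IsInducedCycle {n k : ℕ} (G : Graph n) (c : Fin k → Fin n) : Set where
  field
    length≥3  : 3 ≤ k
    injective : Injective _≡_ _≡_ c
    edges     : ∀ i j → CycSucc k i j → Adj G (c i) (c j)
    chordless : ∀ i j → Adj G (c i) (c j) → CycAdj k i j

OnSeq : ∀ {n k} → (Fin k → Fin n) → Fin n → Set
OnSeq c x = ∃ λ i → c i ≡ x

InducesPath : ∀ {n} → Graph n → (Fin n → Set) → Set
InducesPath {n} G D =
  Σ ℕ λ l → Σ (Fin l → Fin n) λ p →
    (1 ≤ l) × Injective _≡_ _≡_ p × (∀ i → D (p i)) × (∀ x → D x → OnSeq p x)
    × (∀ i j → Adj G (p i) (p j) → PathAdj l i j)
    × (∀ i j → PathAdj l i j → Adj G (p i) (p j))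

InducesCycle : ∀ {n} → Graph n → (Fin n → Set) → Set
InducesCycle {n} G D =
  Σ ℕ λ k → Σ (Fin k → Fin n) λ c →
    IsInducedCycle G c × (∀ i → D (c i)) × (∀ x → D x → OnSeq c x)

record PermTwoFactor {m : ℕ} (G : Graph (2 * m)) (c₁ c₂ : Fin m → Fin (2 * m)) : Set where
  field
    cycle₁   : IsInducedCycle G c₁
    cycle₂   : IsInducedCycle G c₂
    disjoint : ∀ i j → c₁ i ≢ c₂ j
    covering : ∀ x → OnSeq c₁ x ⊎ OnSeq c₂ x

Deg3On : ∀ {n k} → Graph n → (Fin k → Fin n) → Fin n → Set
Deg3On G c x = OnSeq c x × (deg G x ≡ 3)

Deg2On : ∀ {n k} → Graph n → (Fin k → Fin n) → Fin n → Set
Deg2On G c x = OnSeq c x × (deg G x ≡ 2)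

InducesPathOrCycle : ∀ {n} → Graph n → (Fin n → Set) → Set
InducesPathOrCycle G D = InducesPath G D ⊎ InducesCycle G D

record ConsecPermTwoFactor {m : ℕ} (G : Graph (2 * m)) (c₁ c₂ : Fin m → Fin (2 * m)) : Set where
  field
    perm        : PermTwoFactor G c₁ c₂
    consecutive : InducesPathOrCycle G (Deg3On G c₁) ⊎ InducesPathOrCycle G (Deg3On G c₂)

-- S(c): if the degree-3 vertices on c induce a path P, the degree-2 vertices of c
-- adjacent on c to P; otherwise empty.
InS : ∀ {n k} → Graph n → (Fin k → Fin n) → Fin n → Set
InS {k = k} G c x =
  InducesPath G (Deg3On G c) × (deg G x ≡ 2)
  × (∃ λ a → ∃ λ b → (c a ≡ x) × CycAdj k a b × Deg3On G c (c b))

Eligible : ∀ {n k} → Graph n → (c₁ c₂ : Fin k → Fin n) → Fin n → Fin n → Set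
Eligible G c₁ c₂ u v =
    (InS G c₁ u × Deg2On G c₂ v) ⊎ (InS G c₂ u × Deg2On G c₁ v)
  ⊎ (InS G c₁ v × Deg2On G c₂ u) ⊎ (InS G c₂ v × Deg2On G c₁ u)

module Submission where

-- In H = G + uv both u and v have degree 3. In a permutation 2-factor of a subcubic graph every degree-3
-- vertex has exactly one neighbour on the other cycle, so each cycle carries half of the degree-3 vertices;
-- hence all cycles of all permutation 2-factors of H carry equally many degree-3 and degree-2 vertices.
-- Let u ∈ S(a) have neighbours p (degree 3) and w on a, and let v ∈ b have neighbours v₁, v₂. By hypothesis
-- at most one of w, v₁, v₂ has degree 3 in H, and w does not (else all of a, hence all of b, would).
-- Let (d, d′) be a consecutive permutation 2-factor of H. If u, v were both on d, then either only u and v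
-- have degree 3 on d, and d, running from u through w along a over degree-2 vertices, would reach p ∉ d;
-- or the degree-2 vertices of d′ would all lie on a or all on b, although w ∈ a and the other d-neighbour of
-- v ∈ b are degree-2 vertices off d′. So uv is a rung of (d, d′), both cycles are induced in G, and on the
-- cycle through u (or v) the degree-3 vertices in G are those in H minus u (or v), which ends their path.

open import Defs
open import Data.Nat using (ℕ; zero; suc; _+_; _*_; _∸_; _≤_; _<_; z≤n; s≤s)
open import Data.Fin using (Fin)
open import Data.Bool using (T)
open import Data.Empty using (⊥; ⊥-elim)
open import Data.Product using (∃; _×_; _,_; proj₁; proj₂)
open import Data.Sum using (_⊎_; inj₁; inj₂)
import Data.Sum
open import Data.List using (List; []; _∷_; length)
open import Data.List.Relation.Unary.All using (All; []; _∷_)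
open import Data.List.Relation.Unary.AllPairs using ([]; _∷_)
open import Data.List.Relation.Unary.Any using (here; there)
open import Data.List.Membership.Propositional using (_∈_)
open import Data.List.Relation.Unary.Unique.Propositional using (Unique)
open import Function using (_∘_; case_of_)
open import Function.Definitions using (Injective)
open import Relation.Nullary using (¬_; Dec; yes; no)
open import Relation.Nullary.Decidable using (T?)
open import Relation.Unary using (Decidable; _⊆_)
open import Relation.Binary.PropositionalEquality

module Counting where

  open import Data.Nat.Properties using (+-0-commutativeMonoid; +-mono-≤; ≤-antisym; ≤-trans; ≤-reflexive; module ≤-Reasoning)
  open import Data.Fin using (zero; suc; _≟_; punchIn)
  open import Data.Fin.Properties using (any?; suc-injective; punchInᵢ≢i)
  open import Data.Fin.Permutation using (permutation)
  open import Data.List using (filter; tabulate)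
  import Data.List.Relation.Unary.All as All
  open import Relation.Unary.Properties using (_∩?_; ∁?)
  import Algebra.Properties.CommutativeMonoid.Sum as Sum
  open Sum +-0-commutativeMonoid using (sum; sum-cong-≗; ∑-distrib-+; sum-permute; sum-remove; sum-replicate-zero)

  private
    variable
      N : ℕ
      P Q R : Fin N → Set

  indicator : {A : Set} → Dec A → ℕ
  indicator (yes _) = 1
  indicator (no _) = 0

  indicator-yes : {A : Set} (A? : Dec A) → A → indicator A? ≡ 1
  indicator-yes (yes _) _ = refl
  indicator-yes (no ¬a) a = ⊥-elim (¬a a)

  indicator-no : {A : Set} (A? : Dec A) → ¬ A → indicator A? ≡ 0
  indicator-no (yes a) ¬a = ⊥-elim (¬a a)
  indicator-no (no _)  _  = refl

  count : Decidable P → ℕ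
  count P? = sum (indicator ∘ P?)

  sum-mono : ∀ {M} {f g : Fin M → ℕ} → (∀ x → f x ≤ g x) → sum f ≤ sum g
  sum-mono {zero}  f≤g = z≤n
  sum-mono {suc M} f≤g = +-mono-≤ (f≤g zero) (sum-mono (f≤g ∘ suc))

  count-mono : (P? : Decidable P) (Q? : Decidable Q) → P ⊆ Q → count P? ≤ count Q?
  count-mono P? Q? P⊆Q = sum-mono pointwise
    where
    pointwise : ∀ x → indicator (P? x) ≤ indicator (Q? x)
    pointwise x with P? x | Q? x
    ... | no _  | _     = z≤n
    ... | yes _ | yes _ = s≤s z≤n
    ... | yes p | no ¬q = ⊥-elim (¬q (P⊆Q p))

  count-cong : (P? : Decidable P) (Q? : Decidable Q) → P ⊆ Q → Q ⊆ P → count P? ≡ count Q?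
  count-cong P? Q? P⊆Q Q⊆P = ≤-antisym (count-mono P? Q? P⊆Q) (count-mono Q? P? Q⊆P)

  count-partition : (P? : Decidable P) (Q? : Decidable Q) (R? : Decidable R) →
    P ⊆ (λ x → Q x ⊎ R x) → Q ⊆ P → R ⊆ P → (∀ {x} → Q x → ¬ R x) →
    count P? ≡ count Q? + count R?
  count-partition P? Q? R? P⊆Q∪R Q⊆P R⊆P disjoint =
    trans (sum-cong-≗ pointwise) (∑-distrib-+ (indicator ∘ Q?) (indicator ∘ R?))
    where
    pointwise : ∀ x → indicator (P? x) ≡ indicator (Q? x) + indicator (R? x)
    pointwise x with P? x | Q? x | R? x
    ... | yes _ | yes q | yes r = ⊥-elim (disjoint q r)
    ... | yes _ | yes _ | no _  = refl
    ... | yes _ | no _  | yes _ = refl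
    ... | yes p | no ¬q | no ¬r with P⊆Q∪R p
    ...   | inj₁ q = ⊥-elim (¬q q)
    ...   | inj₂ r = ⊥-elim (¬r r)
    pointwise x | no _ | no _ | no _ = refl
    pointwise x | no ¬p | yes q | _ = ⊥-elim (¬p (Q⊆P q))
    pointwise x | no ¬p | no _ | yes r = ⊥-elim (¬p (R⊆P r))

  count-none : ∀ {N} {P : Fin N → Set} (P? : Decidable P) → (∀ x → ¬ P x) → count P? ≡ 0
  count-none {N} P? none = trans (sum-cong-≗ (λ x → indicator-no (P? x) (none x))) (sum-replicate-zero N)

  count-singleton : ∀ {N} (a : Fin N) → count (a ≟_) ≡ 1
  count-singleton {suc N} a =
    trans (sum-remove {i = a} (indicator ∘ (a ≟_)))
          (cong₂ _+_ (indicator-yes (a ≟ a) refl)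
                     (trans (sum-cong-≗ (λ j → indicator-no (a ≟ punchIn a j) (punchInᵢ≢i a j ∘ sym)))
                            (sum-replicate-zero N)))

  count-split : (P? : Decidable P) (Q? : Decidable Q) → count P? ≡ count (P? ∩? Q?) + count (P? ∩? ∁? Q?)
  count-split {P = P} {Q = Q} P? Q? = count-partition P? (P? ∩? Q?) (P? ∩? ∁? Q?) split proj₁ proj₁ (λ (_ , q) (_ , ¬q) → ¬q q)
    where
    split : ∀ {x} → P x → (P x × Q x) ⊎ (P x × ¬ Q x)
    split {x} p with Q? x
    ... | yes q = inj₁ (p , q)
    ... | no ¬q = inj₂ (p , ¬q)

  count-remove : (P? : Decidable P) {a : Fin N} → P a → count P? ≡ suc (count (P? ∩? ∁? (a ≟_)))
  count-remove P? {a} pa = trans (count-split P? (a ≟_)) (cong (_+ count (P? ∩? ∁? (a ≟_))) singleton)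
    where
    singleton : count (P? ∩? (a ≟_)) ≡ 1
    singleton = trans (count-cong (P? ∩? (a ≟_)) (a ≟_) proj₂ (λ { refl → pa , refl })) (count-singleton a)

  count-strict : (P? : Decidable P) (Q? : Decidable Q) {a : Fin N} → P ⊆ Q → Q a → ¬ P a → count P? < count Q?
  count-strict P? Q? P⊆Q qa ¬pa = ≤-trans (s≤s (count-mono P? (Q? ∩? ∁? (_ ≟_)) (λ p → P⊆Q p , λ { refl → ¬pa p })))
                                           (≤-reflexive (sym (count-remove Q? qa)))

  length≤count : (P? : Decidable P) (xs : List (Fin N)) → Unique xs → All P xs → length xs ≤ count P?
  length≤count P? []       _                  _          = z≤n
  length≤count P? (x ∷ xs) (x∉xs ∷ xs-unique) (px ∷ pxs) =
    ≤-trans (s≤s (length≤count (P? ∩? ∁? (x ≟_)) xs xs-unique (All.zip (pxs , x∉xs))))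
            (≤-reflexive (sym (count-remove P? px)))

  count≤length : (P? : Decidable P) (xs : List (Fin N)) → P ⊆ (_∈ xs) → count P? ≤ length xs
  count≤length P? []       P⊆xs = ≤-reflexive (count-none P? (λ x p → case P⊆xs p of λ ()))
  count≤length P? (x ∷ xs) P⊆xs = begin
    count P?                                        ≡⟨ count-split P? (x ≟_) ⟩
    count (P? ∩? (x ≟_)) + count (P? ∩? ∁? (x ≟_))  ≤⟨ +-mono-≤ at-most-x (count≤length _ xs rest⊆xs) ⟩
    1 + length xs                                   ∎
    where
    open ≤-Reasoning
    at-most-x : count (P? ∩? (x ≟_)) ≤ 1
    at-most-x = ≤-trans (count-mono _ (x ≟_) proj₂) (≤-reflexive (count-singleton x))
    rest⊆xs : _ ⊆ (_∈ xs)
    rest⊆xs (p , x≢y) with P⊆xs p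
    ... | here y≡x  = ⊥-elim (x≢y (sym y≡x))
    ... | there y∈xs = y∈xs

  onSeq? : ∀ {m} (c : Fin m → Fin N) → Decidable (OnSeq c)
  onSeq? c x = any? (λ i → c i ≟ x)

  count-image : ∀ {m} (c : Fin m → Fin N) → Injective _≡_ _≡_ c → count (onSeq? c) ≡ m
  count-image {m = zero}  c _ = count-none (onSeq? c) (λ _ ())
  count-image {m = suc m} c c-injective =
    trans (count-remove (onSeq? c) (zero , refl))
          (cong suc (trans (count-cong _ (onSeq? (c ∘ suc)) later earlier)
                           (count-image (c ∘ suc) (suc-injective ∘ c-injective))))
    where
    later : ∀ {x} → OnSeq c x × c zero ≢ x → OnSeq (c ∘ suc) x
    later ((zero  , refl) , c₀≢x) = ⊥-elim (c₀≢x refl)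
    later ((suc i , refl) , _)    = i , refl
    earlier : ∀ {x} → OnSeq (c ∘ suc) x → OnSeq c x × c zero ≢ x
    earlier (i , refl) = (suc i , refl) , λ c₀≡cᵢ → case c-injective c₀≡cᵢ of λ ()

  count-involution : (P? : Decidable P) (Q? : Decidable Q) (ι : Fin N → Fin N) → (∀ x → ι (ι x) ≡ x) →
    (∀ {x} → P x → Q (ι x)) → (∀ {x} → Q (ι x) → P x) → count P? ≡ count Q?
  count-involution P? Q? ι ι-involutive P⇒Qι Qι⇒P =
    trans (sum-cong-≗ pointwise) (sym (sum-permute (indicator ∘ Q?) (permutation ι ι ι-involutive ι-involutive)))
    where
    pointwise : ∀ x → indicator (P? x) ≡ indicator (Q? (ι x))
    pointwise x with P? x | Q? (ι x)
    ... | yes _ | yes _ = refl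
    ... | no _  | no _  = refl
    ... | yes p | no ¬q = ⊥-elim (¬q (P⇒Qι p))
    ... | no ¬p | yes q = ⊥-elim (¬p (Qι⇒P q))

  length-filter-tabulate : ∀ {m} (P? : Decidable P) (f : Fin m → Fin N) →
    length (filter P? (tabulate f)) ≡ sum (indicator ∘ P? ∘ f)
  length-filter-tabulate {m = zero}  P? f = refl
  length-filter-tabulate {m = suc m} P? f with P? (f zero)
  ... | yes _ = cong suc (length-filter-tabulate P? (f ∘ suc))
  ... | no _  = length-filter-tabulate P? (f ∘ suc)

  deg≡count : (K : Graph N) (x : Fin N) → deg K x ≡ count (λ y → T? (K x y))
  deg≡count K x = length-filter-tabulate (λ y → T? (K x y)) (λ y → y)

module CyclicOrder (n : ℕ) where

  open import Data.Nat using (_%_; _<?_; _≤?_)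
  open import Data.Nat.Properties
  open import Data.Nat.DivMod using (m%n<n; %-distribˡ-+; m%n%n≡m%n; m<n⇒m%n≡m; m≤n⇒[n∸m]%m≡n%m; [m+n]%n≡m%n; n%n≡0)
  open import Data.Fin using (toℕ; fromℕ<)
  open import Data.Fin.Properties using (toℕ-fromℕ<; toℕ<n; toℕ-injective)

  private
    M : ℕ
    M = suc n

  next : Fin M → Fin M
  next i = fromℕ< (m%n<n (suc (toℕ i)) M)

  advance : ℕ → Fin M → Fin M
  advance zero    s = s
  advance (suc j) s = next (advance j s)

  prev : Fin M → Fin M
  prev = advance n

  toℕ-advance : ∀ j s → toℕ (advance j s) ≡ (toℕ s + j) % M
  toℕ-advance zero    s = trans (sym (m<n⇒m%n≡m (toℕ<n s))) (cong (_% M) (sym (+-identityʳ (toℕ s))))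
  toℕ-advance (suc j) s = begin
    toℕ (next (advance j s))           ≡⟨ toℕ-fromℕ< _ ⟩
    suc (toℕ (advance j s)) % M        ≡⟨ cong (λ k → suc k % M) (toℕ-advance j s) ⟩
    suc ((toℕ s + j) % M) % M          ≡⟨ %-distribˡ-+ 1 ((toℕ s + j) % M) M ⟩
    (1 % M + (toℕ s + j) % M % M) % M  ≡⟨ cong (λ k → (1 % M + k) % M) (m%n%n≡m%n (toℕ s + j) M) ⟩
    (1 % M + (toℕ s + j) % M) % M      ≡⟨ %-distribˡ-+ 1 (toℕ s + j) M ⟨
    suc (toℕ s + j) % M                ≡⟨ cong (_% M) (+-suc (toℕ s) j) ⟨
    (toℕ s + suc j) % M                ∎
    where open ≡-Reasoning

  private
    mod-cases : ∀ s j → s < M → j < M →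
      (s + j < M × (s + j) % M ≡ s + j) ⊎ (M ≤ s + j × (s + j) % M + M ≡ s + j)
    mod-cases s j s<M j<M with s + j <? M
    ... | yes s+j<M = inj₁ (s+j<M , m<n⇒m%n≡m s+j<M)
    ... | no s+j≮M = inj₂ (M≤s+j , wrap)
      where
      open ≡-Reasoning
      M≤s+j : M ≤ s + j
      M≤s+j = ≮⇒≥ s+j≮M
      s+j∸M<M : s + j ∸ M < M
      s+j∸M<M = +-cancelʳ-< _ _ _ (subst (_< M + M) (sym (m∸n+n≡m M≤s+j)) (+-mono-< s<M j<M))
      wrap : (s + j) % M + M ≡ s + j
      wrap = begin
        (s + j) % M + M       ≡⟨ cong (_+ M) (m≤n⇒[n∸m]%m≡n%m M≤s+j) ⟨
        (s + j ∸ M) % M + M   ≡⟨ cong (_+ M) (m<n⇒m%n≡m s+j∸M<M) ⟩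
        (s + j ∸ M) + M       ≡⟨ m∸n+n≡m M≤s+j ⟩
        s + j                 ∎

  advance-injective : ∀ s {j j'} → j < M → j' < M → advance j s ≡ advance j' s → j ≡ j'
  advance-injective s {j} {j'} j<M j'<M eq =
    cases (mod-cases (toℕ s) j (toℕ<n s) j<M) (mod-cases (toℕ s) j' (toℕ<n s) j'<M)
    where
    mods : (toℕ s + j) % M ≡ (toℕ s + j') % M
    mods = trans (sym (toℕ-advance j s)) (trans (cong toℕ eq) (toℕ-advance j' s))
    wrapped≢unwrapped : ∀ {a b} → toℕ s + a < M → (toℕ s + a) % M ≡ toℕ s + a →
      (toℕ s + b) % M + M ≡ toℕ s + b → (toℕ s + a) % M ≡ (toℕ s + b) % M → b < M → ⊥
    wrapped≢unwrapped {a} {b} _ a-mod b-mod ab-mod b<M =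
      <-irrefl refl (<-≤-trans b<M (subst (M ≤_) a+M≡b (m≤n+m M a)))
      where
      a+M≡b : a + M ≡ b
      a+M≡b = +-cancelˡ-≡ (toℕ s) _ _
        (trans (sym (+-assoc (toℕ s) a M)) (trans (cong (_+ M) (trans (sym a-mod) ab-mod)) b-mod))
    cases : _ → _ → j ≡ j'
    cases (inj₁ (_ , p)) (inj₁ (_ , q)) = +-cancelˡ-≡ (toℕ s) _ _ (trans (sym p) (trans mods q))
    cases (inj₂ (_ , p)) (inj₂ (_ , q)) = +-cancelˡ-≡ (toℕ s) _ _ (trans (sym p) (trans (cong (_+ M) mods) q))
    cases (inj₁ (lt , p)) (inj₂ (_ , q)) = ⊥-elim (wrapped≢unwrapped lt p q mods j'<M)
    cases (inj₂ (_ , p)) (inj₁ (lt , q)) = ⊥-elim (wrapped≢unwrapped lt q p (sym mods) j<M)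

  advance-surjective : ∀ s i → ∃ λ j → j < M × advance j s ≡ i
  advance-surjective s i with toℕ s ≤? toℕ i
  ... | yes s≤i = toℕ i ∸ toℕ s , ≤-<-trans (m∸n≤m (toℕ i) (toℕ s)) (toℕ<n i) ,
        toℕ-injective (trans (toℕ-advance _ s) (trans (cong (_% M) (m+[n∸m]≡n s≤i)) (m<n⇒m%n≡m (toℕ<n i))))
  ... | no s≰i = toℕ i + M ∸ toℕ s , j<M ,
        toℕ-injective (trans (toℕ-advance _ s)
          (trans (cong (_% M) (m+[n∸m]≡n s≤i+M)) (trans ([m+n]%n≡m%n (toℕ i) M) (m<n⇒m%n≡m (toℕ<n i)))))
    where
    s≤i+M : toℕ s ≤ toℕ i + M
    s≤i+M = ≤-trans (<⇒≤ (toℕ<n s)) (m≤n+m M (toℕ i))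
    j<M : toℕ i + M ∸ toℕ s < M
    j<M = +-cancelʳ-< _ _ _ (subst (_< M + toℕ s) (sym (m∸n+n≡m s≤i+M))
            (subst (toℕ i + M <_) (+-comm (toℕ s) M) (+-monoˡ-< M (≰⇒> s≰i))))

  advance-+ : ∀ j k s → advance j (advance k s) ≡ advance (j + k) s
  advance-+ zero    k s = refl
  advance-+ (suc j) k s = cong next (advance-+ j k s)

  advance-period : ∀ s → advance M s ≡ s
  advance-period s = toℕ-injective (trans (toℕ-advance M s) (trans ([m+n]%n≡m%n (toℕ s) M) (m<n⇒m%n≡m (toℕ<n s))))

  next-prev : ∀ i → next (prev i) ≡ i
  next-prev = advance-period

  prev-next : ∀ i → prev (next i) ≡ i
  prev-next i = trans (advance-+ n 1 i) (trans (cong (λ k → advance k i) (+-comm n 1)) (advance-period i))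

  advance-next : ∀ j s → advance j (next s) ≡ advance (suc j) s
  advance-next j s = trans (advance-+ j 1 s) (cong (λ k → advance k s) (+-comm j 1))

  advance-around : 1 ≤ n → ∀ s → advance (n ∸ 1) (next s) ≡ prev s
  advance-around 1≤n s = trans (advance-next (n ∸ 1) s) (cong (λ k → advance k s) (sym (+-∸-assoc 1 1≤n)))

  advance≢self : ∀ {j} s → suc j < M → advance (suc j) s ≢ s
  advance≢self s sj<M eq with advance-injective s sj<M (s≤s z≤n) eq
  ... | ()

  CycSucc⇒next : ∀ {i j} → CycSucc M i j → j ≡ next i
  CycSucc⇒next {i} {j} (inj₁ 1+i≡j) =
    toℕ-injective (trans (sym (trans (m<n⇒m%n≡m (subst (_< M) (sym 1+i≡j) (toℕ<n j))) 1+i≡j)) (sym (toℕ-fromℕ< _)))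
  CycSucc⇒next {i} {j} (inj₂ (1+i≡M , j≡0)) =
    toℕ-injective (trans j≡0 (sym (trans (toℕ-fromℕ< _) (trans (cong (_% M) 1+i≡M) (n%n≡0 M)))))

  CycSucc-next : ∀ i → CycSucc M i (next i)
  CycSucc-next i with m≤n⇒m<n∨m≡n (toℕ<n i)
  ... | inj₁ 1+i<M = inj₁ (sym (trans (toℕ-fromℕ< _) (m<n⇒m%n≡m 1+i<M)))
  ... | inj₂ 1+i≡M = inj₂ (1+i≡M , trans (toℕ-fromℕ< _) (trans (cong (_% M) 1+i≡M) (n%n≡0 M)))

  CycAdj⇒next⊎prev : ∀ {i j} → CycAdj M i j → j ≡ next i ⊎ j ≡ prev i
  CycAdj⇒next⊎prev (inj₁ i→j) = inj₁ (CycSucc⇒next i→j)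
  CycAdj⇒next⊎prev {i} {j} (inj₂ j→i) = inj₂ (trans (sym (prev-next j)) (cong prev (sym (CycSucc⇒next j→i))))

  next≢prev : 2 ≤ n → ∀ i → next i ≢ prev i
  next≢prev 2≤n i eq with advance-injective i {1} {n} (s≤s (≤-trans (s≤s z≤n) 2≤n)) (n<1+n n) eq
  ... | refl with 2≤n
  ... | s≤s ()

  next≢self : 1 ≤ n → ∀ i → next i ≢ i
  next≢self 1≤n i eq with advance-injective i {1} {0} (s≤s 1≤n) (s≤s z≤n) eq
  ... | ()

  record Arc (A : Fin M → Set) : Set where
    field
      start    : Fin M
      size     : ℕ
      member   : ∀ {j} → j < size → A (advance j start)
      position : ∀ {i} → A i → ∃ λ j → j < size × advance j start ≡ i

  Arc-cong : ∀ {A B : Fin M → Set} → (∀ {i} → A i → B i) → (∀ {i} → B i → A i) → Arc A → Arc B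
  Arc-cong A⇒B B⇒A arc = record
    { start = start ; size = size
    ; member = λ j<size → A⇒B (member j<size)
    ; position = λ Bi → position (B⇒A Bi) }
    where open Arc arc

  module _ (walk : ℕ → Fin M) (L : ℕ)
    (step : ∀ j → suc j < L → walk (suc j) ≡ next (walk j) ⊎ walk (suc j) ≡ prev (walk j))
    (walk-injective : ∀ {j j'} → j < L → j' < L → walk j ≡ walk j' → j ≡ j') where

    private
      Visited : Fin M → Set
      Visited i = ∃ λ j → j < L × walk j ≡ i

      sj<L⇒j<L : ∀ {j} → suc j < L → j < L
      sj<L⇒j<L = <-trans (n<1+n _)

      j≢2+j : ∀ {j} → j ≢ suc (suc j)
      j≢2+j ()

      -- A walk that never revisits a position cannot turn back.
      forwards : walk 1 ≡ next (walk 0) → ∀ j → suc j < L → walk (suc j) ≡ next (walk j)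
      forwards first zero    _ = first
      forwards first (suc j) sj<L with step (suc j) sj<L
      ... | inj₁ fwd = fwd
      ... | inj₂ back = ⊥-elim (j≢2+j (walk-injective (sj<L⇒j<L (sj<L⇒j<L sj<L)) sj<L
              (sym (trans back (trans (cong prev (forwards first j (sj<L⇒j<L sj<L))) (prev-next (walk j)))))))

      backwards : walk 1 ≡ prev (walk 0) → ∀ j → suc j < L → walk (suc j) ≡ prev (walk j)
      backwards first zero    _ = first
      backwards first (suc j) sj<L with step (suc j) sj<L
      ... | inj₂ back = back
      ... | inj₁ fwd = ⊥-elim (j≢2+j (walk-injective (sj<L⇒j<L (sj<L⇒j<L sj<L)) sj<L
              (sym (trans fwd (trans (cong next (backwards first j (sj<L⇒j<L sj<L))) (next-prev (walk j)))))))

      walk-forwards : (∀ j → suc j < L → walk (suc j) ≡ next (walk j)) → ∀ j → j < L → walk j ≡ advance j (walk 0)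
      walk-forwards fwd zero    _   = refl
      walk-forwards fwd (suc j) sj<L = trans (fwd j sj<L) (cong next (walk-forwards fwd j (sj<L⇒j<L sj<L)))

      reversed<L : ∀ {j} → j < L → L ∸ suc j < L
      reversed<L j<L = ∸-monoʳ-< {L} {suc _} {0} (s≤s z≤n) j<L

      walk-backwards : (∀ j → suc j < L → walk (suc j) ≡ prev (walk j)) →
        ∀ j → j < L → walk (L ∸ suc j) ≡ advance j (walk (L ∸ 1))
      walk-backwards back zero    _   = refl
      walk-backwards back (suc j) sj<L = begin
        walk k                    ≡⟨ next-prev (walk k) ⟨
        next (prev (walk k))      ≡⟨ cong next (back k sk<L) ⟨
        next (walk (suc k))       ≡⟨ cong (next ∘ walk) sk≡L-sj ⟩
        next (walk (L ∸ suc j))   ≡⟨ cong next (walk-backwards back j (sj<L⇒j<L sj<L)) ⟩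
        advance (suc j) (walk (L ∸ 1)) ∎
        where
        open ≡-Reasoning
        k : ℕ
        k = L ∸ suc (suc j)
        sk≡L-sj : suc k ≡ L ∸ suc j
        sk≡L-sj = sym (+-∸-assoc 1 sj<L)
        sk<L : suc k < L
        sk<L = subst (_< L) (sym sk≡L-sj) (reversed<L (sj<L⇒j<L sj<L))

      reversed-involutive : ∀ {j} → j < L → L ∸ suc (L ∸ suc j) ≡ j
      reversed-involutive j<L = trans (cong (L ∸_) (sym (+-∸-assoc 1 j<L))) (m∸[m∸n]≡n (<⇒≤ j<L))

    walk-arc : Arc Visited
    walk-arc with 1 <? L
    ... | no 1≮L = record
      { start = walk 0 ; size = L
      ; member = λ j<L → 0 , ≤-<-trans z≤n j<L , cong (λ k → advance k (walk 0)) (sym (only-zero j<L))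
      ; position = λ { (j , j<L , refl) → 0 , ≤-<-trans z≤n j<L , cong walk (sym (only-zero j<L)) } }
      where
      only-zero : ∀ {j} → j < L → j ≡ 0
      only-zero {zero}  _   = refl
      only-zero {suc j} sj<L = ⊥-elim (1≮L (≤-<-trans (s≤s z≤n) sj<L))
    ... | yes 1<L with step 0 1<L
    ... | inj₁ first = record
      { start = walk 0 ; size = L
      ; member = λ {j} j<L → j , j<L , walk-forwards (forwards first) j j<L
      ; position = λ { (j , j<L , refl) → j , j<L , sym (walk-forwards (forwards first) j j<L) } }
    ... | inj₂ first = record
      { start = walk (L ∸ 1) ; size = L
      ; member = λ {j} j<L → L ∸ suc j , reversed<L j<L , walk-backwards (backwards first) j j<L
      ; position = λ { (j , j<L , refl) → L ∸ suc j , reversed<L j<L ,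
          trans (sym (walk-backwards (backwards first) (L ∸ suc j) (reversed<L j<L))) (cong walk (reversed-involutive j<L)) } }

  -- An arc missing α but containing both neighbours of α must start at next α and run all the way round to prev α.
  arc-complement : 1 ≤ n → {A : Fin M → Set} → Arc A → ∀ {α} → ¬ A α → A (next α) → A (prev α) → ∀ {i} → i ≢ α → A i
  arc-complement 1≤n {A} arc {α} ¬Aα A-next A-prev {i} i≢α
    with advance-surjective (Arc.start arc) α | advance-surjective (Arc.start arc) i
  ... | j , j<M , refl | k , k<M , refl = member k<size
    where
    open Arc arc
    size≤j : size ≤ j
    size≤j = ≮⇒≥ (¬Aα ∘ member)
    size<M : size < M
    size<M = ≤-<-trans size≤j j<M
    j≡n : j ≡ n
    j≡n with m≤n⇒m<n∨m≡n (≤-pred j<M)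
    ... | inj₂ j≡n = j≡n
    ... | inj₁ j<n with position A-next
    ... | j′ , j′<size , eq = ⊥-elim (<-irrefl refl (<-≤-trans (<-trans (n<1+n j) (subst (_< size) (sym sj≡j′) j′<size)) size≤j))
      where
      sj≡j′ : suc j ≡ j′
      sj≡j′ = advance-injective start (s≤s j<n) (<-trans j′<size size<M) (sym eq)
    sn-1≡n : suc (n ∸ 1) ≡ n
    sn-1≡n = sym (+-∸-assoc 1 1≤n)
    n-1<size : n ∸ 1 < size
    n-1<size with position A-prev
    ... | j′ , j′<size , eq = subst (_< size) (advance-injective start (<-trans j′<size size<M) (≤-<-trans (m∸n≤m n 1) (n<1+n n))
            (trans eq (sym (trans (sym (prev-next _)) (cong (λ l → prev (advance l start)) (trans sn-1≡n (sym j≡n))))))) j′<size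
    k<size : k < size
    k<size with m≤n⇒m<n∨m≡n (≤-pred k<M)
    ... | inj₂ k≡n = ⊥-elim (i≢α (cong (λ l → advance l start) (trans k≡n (sym j≡n))))
    ... | inj₁ k<n = ≤-<-trans (≤-pred (subst (suc k ≤_) (sym sn-1≡n) k<n)) n-1<size

module SymmetricGraph {N : ℕ} (K : Graph N) (K-sym : ∀ x y → K x y ≡ K y x) where

  open import Data.Nat using (_<?_)
  import Data.Nat as ℕ
  open import Data.Nat.Properties using (≤-trans; ≤-pred; <-trans; n<1+n; ≤-refl; n≤1+n; m≤n⇒m<n∨m≡n; ≤-antisym; <-irrefl; <-≤-trans)
  import Data.Nat.Properties as ℕₚ
  open import Data.Fin using (zero; suc; toℕ; fromℕ<; fromℕ; inject₁; lower₁; _≟_)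
  open import Data.Fin.Properties using (toℕ-fromℕ<; fromℕ<-toℕ; toℕ<n; any?; suc-injective; inject₁-injective; toℕ-inject₁; toℕ-fromℕ; toℕ-injective; inject₁-lower₁; toℕ-lower₁)
  open import Relation.Nullary.Decidable using (¬?; _×-dec_)

  open Counting

  adj-sym : ∀ {x y} → Adj K x y → Adj K y x
  adj-sym {x} {y} = subst T (K-sym x y)

  deg≡3⇒deg≢2 : ∀ {x} → deg K x ≡ 3 → deg K x ≢ 2
  deg≡3⇒deg≢2 deg≡3 deg≡2 = case trans (sym deg≡3) deg≡2 of λ ()

  length≤deg : ∀ {x} xs → Unique xs → All (Adj K x) xs → length xs ≤ deg K x
  length≤deg {x} xs xs-unique xs-adj =
    subst (length xs ≤_) (sym (deg≡count K x)) (length≤count (λ y → T? (K x y)) xs xs-unique xs-adj)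

  deg≤length : ∀ {x} xs → (∀ {y} → Adj K x y → y ∈ xs) → deg K x ≤ length xs
  deg≤length {x} xs ⊆xs = subst (_≤ length xs) (sym (deg≡count K x)) (count≤length (λ y → T? (K x y)) xs ⊆xs)

  deg≡3⇒neighbours : ∀ {x a b c} → deg K x ≡ 3 → Adj K x a → Adj K x b → Adj K x c → a ≢ b → a ≢ c → b ≢ c →
    ∀ {y} → Adj K x y → y ≡ a ⊎ y ≡ b ⊎ y ≡ c
  deg≡3⇒neighbours {x} {a} {b} {c} deg≡3 xa xb xc a≢b a≢c b≢c {y} xy with y ≟ a | y ≟ b | y ≟ c
  ... | yes y≡a | _       | _       = inj₁ y≡a
  ... | no _    | yes y≡b | _       = inj₂ (inj₁ y≡b)
  ... | no _    | no _    | yes y≡c = inj₂ (inj₂ y≡c)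
  ... | no y≢a  | no y≢b  | no y≢c  with subst (4 ≤_) deg≡3 (length≤deg (a ∷ b ∷ c ∷ y ∷ [])
        ((a≢b ∷ a≢c ∷ (y≢a ∘ sym) ∷ []) ∷ (b≢c ∷ (y≢b ∘ sym) ∷ []) ∷ ((y≢c ∘ sym) ∷ []) ∷ [] ∷ [])
        (xa ∷ xb ∷ xc ∷ xy ∷ []))
  ... | s≤s (s≤s (s≤s ()))

  private
    consecutive-closure : ∀ {l} (Z : Fin l → Set) → (∀ i j → suc (toℕ i) ≡ toℕ j → (Z i → Z j) × (Z j → Z i)) →
      ∀ {t} → Z t → ∀ i → Z i
    consecutive-closure {l} Z step {t} Zt i =
      subst Z (fromℕ<-toℕ i _) (proj₂ (chain (toℕ i) (toℕ<n i) 0<l) (proj₁ (chain (toℕ t) (toℕ<n t) 0<l) (subst Z (sym (fromℕ<-toℕ t _)) Zt)))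
      where
      0<l : 0 < l
      0<l = <-≤-trans (s≤s z≤n) (toℕ<n t)
      chain : ∀ j (j<l : j < l) (0<l : 0 < l) → (Z (fromℕ< j<l) → Z (fromℕ< 0<l)) × (Z (fromℕ< 0<l) → Z (fromℕ< j<l))
      chain zero    j<l 0<l = (λ z → z) , (λ z → z)
      chain (suc j) sj<l 0<l with chain j (<-trans (n<1+n j) sj<l) 0<l
                                | step (fromℕ< (<-trans (n<1+n j) sj<l)) (fromℕ< sj<l)
                                       (trans (cong suc (toℕ-fromℕ< _)) (sym (toℕ-fromℕ< sj<l)))
      ... | (down , up) | (forward , backward) = (down ∘ backward) , (forward ∘ up)

  propagate : ∀ {D S : Fin N → Set} → InducesPathOrCycle K D →
    (∀ {x y} → D x → D y → Adj K x y → S x → S y) → ∀ {x₀} → D x₀ → S x₀ → ∀ {y} → D y → S y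
  propagate {D} {S} (inj₁ (l , p , _ , _ , p∈D , D⊆p , _ , consecutive⇒adj)) spread Dx₀ Sx₀ Dy
    with D⊆p _ Dx₀ | D⊆p _ Dy
  ... | t , refl | j , refl = consecutive-closure (S ∘ p) step Sx₀ j
    where
    step : ∀ i j → suc (toℕ i) ≡ toℕ j → (S (p i) → S (p j)) × (S (p j) → S (p i))
    step i j i→j = spread (p∈D i) (p∈D j) (consecutive⇒adj i j (inj₁ i→j)) ,
                   spread (p∈D j) (p∈D i) (adj-sym (consecutive⇒adj i j (inj₁ i→j)))
  propagate {D} {S} (inj₂ (k , c , cycle , c∈D , D⊆c)) spread Dx₀ Sx₀ Dy
    with D⊆c _ Dx₀ | D⊆c _ Dy
  ... | t , refl | j , refl = consecutive-closure (S ∘ c) step Sx₀ j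
    where
    step : ∀ i j → suc (toℕ i) ≡ toℕ j → (S (c i) → S (c j)) × (S (c j) → S (c i))
    step i j i→j = spread (c∈D i) (c∈D j) (IsInducedCycle.edges cycle i j (inj₁ i→j)) ,
                   spread (c∈D j) (c∈D i) (adj-sym (IsInducedCycle.edges cycle i j (inj₁ i→j)))

  module OnInducedCycle {n : ℕ} {c : Fin (suc n) → Fin N} (cycle : IsInducedCycle K c) where

    open IsInducedCycle cycle
    open CyclicOrder n

    2≤n : 2 ≤ n
    2≤n = ≤-pred length≥3

    adj-next : ∀ i → Adj K (c i) (c (next i))
    adj-next i = edges i (next i) (CycSucc-next i)

    adj-prev : ∀ i → Adj K (c i) (c (prev i))
    adj-prev i = adj-sym (edges (prev i) i (subst (CycSucc (suc n) (prev i)) (next-prev i) (CycSucc-next (prev i))))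

    adj⇒next⊎prev : ∀ {i j} → Adj K (c i) (c j) → j ≡ next i ⊎ j ≡ prev i
    adj⇒next⊎prev {i} {j} a = CycAdj⇒next⊎prev (chordless i j a)

    c-next≢c-prev : ∀ i → c (next i) ≢ c (prev i)
    c-next≢c-prev i eq = next≢prev 2≤n i (injective eq)

    c-next≢c : ∀ i → c (next i) ≢ c i
    c-next≢c i eq = next≢self (≤-trans (s≤s z≤n) 2≤n) i (injective eq)

    c-prev≢c : ∀ i → c (prev i) ≢ c i
    c-prev≢c i eq = c-next≢c i (trans (cong (c ∘ next) (sym (injective eq))) (cong c (next-prev i)))

    2≤deg : ∀ i → 2 ≤ deg K (c i)
    2≤deg i = length≤deg (c (next i) ∷ c (prev i) ∷ []) ((c-next≢c-prev i ∷ []) ∷ [] ∷ []) (adj-next i ∷ adj-prev i ∷ [])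

    off-cycle-neighbour⇒3≤deg : ∀ {i y} → Adj K (c i) y → y ≢ c (next i) → y ≢ c (prev i) → 3 ≤ deg K (c i)
    off-cycle-neighbour⇒3≤deg {i} {y} a y≢next y≢prev =
      length≤deg (c (next i) ∷ c (prev i) ∷ y ∷ [])
        ((c-next≢c-prev i ∷ (y≢next ∘ sym) ∷ []) ∷ ((y≢prev ∘ sym) ∷ []) ∷ [] ∷ []) (adj-next i ∷ adj-prev i ∷ a ∷ [])

    deg≡2⇒neighbours : ∀ {i y} → deg K (c i) ≡ 2 → Adj K (c i) y → y ≡ c (next i) ⊎ y ≡ c (prev i)
    deg≡2⇒neighbours {i} {y} deg≡2 a with y ≟ c (next i) | y ≟ c (prev i)
    ... | yes y≡next | _          = inj₁ y≡next
    ... | no _       | yes y≡prev = inj₂ y≡prev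
    ... | no y≢next  | no y≢prev  with subst (3 ≤_) deg≡2 (off-cycle-neighbour⇒3≤deg a y≢next y≢prev)
    ... | s≤s (s≤s ())

    deg≡2⇒neighbours-on-cycle : ∀ {x y} → OnSeq c x → deg K x ≡ 2 → Adj K x y → OnSeq c y
    deg≡2⇒neighbours-on-cycle (i , refl) deg≡2 a with deg≡2⇒neighbours deg≡2 a
    ... | inj₁ y≡next = next i , sym y≡next
    ... | inj₂ y≡prev = prev i , sym y≡prev

    module _ (subcubic : ∀ x → deg K x ≤ 3) where

      deg≡2⊎deg≡3 : ∀ i → deg K (c i) ≡ 2 ⊎ deg K (c i) ≡ 3
      deg≡2⊎deg≡3 i with m≤n⇒m<n∨m≡n (subcubic (c i))
      ... | inj₂ deg≡3 = inj₂ deg≡3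
      ... | inj₁ (s≤s deg≤2) with m≤n⇒m<n∨m≡n deg≤2
      ... | inj₂ deg≡2 = inj₁ deg≡2
      ... | inj₁ (s≤s deg<2) with ≤-trans (2≤deg i) deg<2
      ... | s≤s ()

      off-cycle-neighbour⇒deg≡3 : ∀ {x y} → OnSeq c x → Adj K x y → ¬ OnSeq c y → deg K x ≡ 3
      off-cycle-neighbour⇒deg≡3 (i , refl) a y∉c =
        ≤-antisym (subcubic (c i)) (off-cycle-neighbour⇒3≤deg a (λ { refl → y∉c (_ , refl) }) (λ { refl → y∉c (_ , refl) }))

      off-cycle-neighbour-unique : ∀ {i y z} → Adj K (c i) y → Adj K (c i) z →
        y ≢ c (next i) → y ≢ c (prev i) → z ≢ c (next i) → z ≢ c (prev i) → y ≡ z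
      off-cycle-neighbour-unique {i} {y} {z} iy iz y≢next y≢prev z≢next z≢prev with y ≟ z
      ... | yes y≡z = y≡z
      ... | no y≢z with ≤-trans (length≤deg (c (next i) ∷ c (prev i) ∷ y ∷ z ∷ [])
              ((c-next≢c-prev i ∷ (y≢next ∘ sym) ∷ (z≢next ∘ sym) ∷ []) ∷ ((y≢prev ∘ sym) ∷ (z≢prev ∘ sym) ∷ []) ∷ (y≢z ∷ []) ∷ [] ∷ [])
              (adj-next i ∷ adj-prev i ∷ iy ∷ iz ∷ []))
              (subcubic (c i))
      ... | s≤s (s≤s (s≤s ()))

    deg≡3⇒off-cycle-neighbour : ∀ {i} → deg K (c i) ≡ 3 → ∃ λ y → Adj K (c i) y × y ≢ c (next i) × y ≢ c (prev i)
    deg≡3⇒off-cycle-neighbour {i} deg≡3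
      with any? (λ y → T? (K (c i) y) ×-dec (¬? (y ≟ c (next i)) ×-dec ¬? (y ≟ c (prev i))))
    ... | yes (y , found) = y , found
    ... | no none = case (subst (_≤ 2) deg≡3 (deg≤length (c (next i) ∷ c (prev i) ∷ []) on-cycle)) of λ { (s≤s (s≤s ())) }
      where
      on-cycle : ∀ {y} → Adj K (c i) y → y ∈ c (next i) ∷ c (prev i) ∷ []
      on-cycle {y} a with y ≟ c (next i) | y ≟ c (prev i)
      ... | yes y≡next | _          = here y≡next
      ... | no _       | yes y≡prev = there (here y≡prev)
      ... | no y≢next  | no y≢prev  = ⊥-elim (none (y , a , y≢next , y≢prev))

    cycle-neighbours : ∀ {i y} → Adj K (c i) y → OnSeq c y → y ≡ c (next i) ⊎ y ≡ c (prev i)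
    cycle-neighbours a (k , refl) = Data.Sum.map (cong c) (cong c) (adj⇒next⊎prev a)

    record OtherCycleNeighbour (x y : Fin N) : Set where
      field
        other               : Fin N
        adj-other           : Adj K x other
        other-on-cycle      : OnSeq c other
        other≢y             : other ≢ y
        neighbours-on-cycle : ∀ {z} → Adj K x z → OnSeq c z → z ≡ other ⊎ z ≡ y

    other-cycle-neighbour : ∀ {x y} → OnSeq c x → OnSeq c y → Adj K x y → OtherCycleNeighbour x y
    other-cycle-neighbour (i , refl) (j , refl) a with adj⇒next⊎prev a
    ... | inj₁ refl = record
      { other = c (prev i) ; adj-other = adj-prev i ; other-on-cycle = prev i , refl
      ; other≢y = c-next≢c-prev i ∘ sym ; neighbours-on-cycle = λ a′ on-c → Data.Sum.swap (cycle-neighbours a′ on-c) }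
    ... | inj₂ refl = record
      { other = c (next i) ; adj-other = adj-next i ; other-on-cycle = next i , refl
      ; other≢y = c-next≢c-prev i ; neighbours-on-cycle = cycle-neighbours }

    module _ (R : Fin N → Set) (spreads : ∀ {x y} → R x → deg K x ≡ 2 → Adj K x y → R y) where

      spread-forwards : ∀ σ L → R (c σ) → (∀ j → j < L → deg K (c (advance j σ)) ≡ 2) → R (c (advance L σ))
      spread-forwards σ zero    Rσ _         = Rσ
      spread-forwards σ (suc L) Rσ degree-2 =
        spreads (spread-forwards σ L Rσ (λ j j<L → degree-2 j (<-trans j<L (n<1+n L)))) (degree-2 L (n<1+n L)) (adj-next (advance L σ))

      spread-backwards : ∀ σ L → R (c (advance L σ)) → (∀ j → 1 ≤ j → j ≤ L → deg K (c (advance j σ)) ≡ 2) → R (c σ)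
      spread-backwards σ zero    R-end _        = R-end
      spread-backwards σ (suc L) R-end degree-2 =
        spread-backwards σ L (spreads R-end (degree-2 (suc L) (s≤s z≤n) ≤-refl) (adj-sym (adj-next (advance L σ))))
          (λ j 1≤j j≤L → degree-2 j 1≤j (≤-trans j≤L (n≤1+n L)))

    sequence-arc : ∀ {l} (q : Fin l → Fin N) → Injective _≡_ _≡_ q →
      (∀ i j → suc (toℕ i) ≡ toℕ j → Adj K (q i) (q j)) → (∀ i → OnSeq c (q i)) → Arc (λ i → OnSeq q (c i))
    sequence-arc {l} q q-injective consecutive⇒adj q-on-c =
      Arc-cong (λ { (j , j<l , refl) → fromℕ< j<l , sym (place-spec j j<l) })
               (λ { (k , qk≡ci) → toℕ k , toℕ<n k ,
                      injective (trans (place-spec (toℕ k) (toℕ<n k)) (trans (cong q (fromℕ<-toℕ k _)) qk≡ci)) })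
               (walk-arc place l step place-injective)
      where
      place : ℕ → Fin (suc n)
      place j with j <? l
      ... | yes j<l = proj₁ (q-on-c (fromℕ< j<l))
      ... | no _    = zero
      place-spec : ∀ j (j<l : j < l) → c (place j) ≡ q (fromℕ< j<l)
      place-spec j j<l with j <? l
      ... | yes _  = proj₂ (q-on-c (fromℕ< j<l))
      ... | no j≮l = ⊥-elim (j≮l j<l)
      step : ∀ j → suc j < l → place (suc j) ≡ next (place j) ⊎ place (suc j) ≡ prev (place j)
      step j sj<l = adj⇒next⊎prev (subst₂ (Adj K) (sym (place-spec j (<-trans (n<1+n j) sj<l))) (sym (place-spec (suc j) sj<l))
        (consecutive⇒adj _ _ (trans (cong suc (toℕ-fromℕ< _)) (sym (toℕ-fromℕ< sj<l)))))
      place-injective : ∀ {j j'} → j < l → j' < l → place j ≡ place j' → j ≡ j'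
      place-injective {j} {j'} j<l j'<l eq =
        trans (sym (toℕ-fromℕ< j<l)) (trans (cong toℕ (q-injective (trans (sym (place-spec j j<l)) (trans (cong c eq) (place-spec j' j'<l))))) (toℕ-fromℕ< j'<l))

    path-or-cycle-arc : ∀ {Q : Fin N → Set} → (∀ {x} → Q x → OnSeq c x) → InducesPathOrCycle K Q → Arc (Q ∘ c)
    path-or-cycle-arc {Q} Q⊆c (inj₁ (l , p , _ , p-injective , p∈Q , Q⊆p , _ , consecutive⇒adj)) =
      Arc-cong (λ { (k , pk≡ci) → subst Q pk≡ci (p∈Q k) }) (Q⊆p _)
        (sequence-arc p p-injective (λ i j i→j → consecutive⇒adj i j (inj₁ i→j)) (Q⊆c ∘ p∈Q))
    path-or-cycle-arc {Q} Q⊆c (inj₂ (k , c′ , cycle′ , c′∈Q , Q⊆c′)) =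
      Arc-cong (λ { (k , c′k≡ci) → subst Q c′k≡ci (c′∈Q k) }) (Q⊆c′ _)
        (sequence-arc c′ (IsInducedCycle.injective cycle′) (λ i j i→j → IsInducedCycle.edges cycle′ i j (inj₁ i→j)) (Q⊆c ∘ c′∈Q))

  module _ {D : Fin N → Set} {l : ℕ} {p : Fin (suc (suc l)) → Fin N} (p-injective : Injective _≡_ _≡_ p)
    (p∈D : ∀ i → D (p i)) (D⊆p : ∀ x → D x → OnSeq p x)
    (adj⇒consecutive : ∀ i j → Adj K (p i) (p j) → PathAdj _ i j) (consecutive⇒adj : ∀ i j → PathAdj _ i j → Adj K (p i) (p j)) where

    private
      D-minus : Fin N → Fin N → Set
      D-minus ρ x = D x × x ≢ ρ

    drop-first : InducesPath K (D-minus (p zero))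
    drop-first = suc l , p ∘ suc , s≤s z≤n , suc-injective ∘ p-injective ,
      (λ i → p∈D (suc i) , λ eq → case p-injective eq of λ ()) ,
      (λ { x (Dx , x≢first) → case D⊆p x Dx of λ { (zero , refl) → ⊥-elim (x≢first refl) ; (suc i , eq) → i , eq } }) ,
      (λ i j a → Data.Sum.map ℕₚ.suc-injective ℕₚ.suc-injective (adj⇒consecutive (suc i) (suc j) a)) ,
      (λ i j i~j → consecutive⇒adj (suc i) (suc j) (Data.Sum.map (cong suc) (cong suc) i~j))

    drop-last : InducesPath K (D-minus (p (fromℕ (suc l))))
    drop-last = suc l , p ∘ inject₁ , s≤s z≤n , inject₁-injective ∘ p-injective ,
      (λ i → p∈D (inject₁ i) , λ eq → inject₁≢last i (p-injective eq)) ,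
      (λ { x (Dx , x≢last) → case D⊆p x Dx of λ { (i , refl) → lower i x≢last } }) ,
      (λ i j a → Data.Sum.map (shift i j) (shift j i) (adj⇒consecutive (inject₁ i) (inject₁ j) a)) ,
      (λ i j i~j → consecutive⇒adj (inject₁ i) (inject₁ j) (Data.Sum.map (unshift i j) (unshift j i) i~j))
      where
      inject₁≢last : ∀ (i : Fin (suc l)) → inject₁ i ≢ fromℕ (suc l)
      inject₁≢last i eq = <-irrefl (trans (sym (toℕ-inject₁ i)) (trans (cong toℕ eq) (toℕ-fromℕ (suc l)))) (toℕ<n i)
      lower : ∀ i → p i ≢ p (fromℕ (suc l)) → OnSeq (p ∘ inject₁) (p i)
      lower i pi≢last with suc l ℕ.≟ toℕ i
      ... | yes eq = ⊥-elim (pi≢last (cong p (toℕ-injective (trans (sym eq) (sym (toℕ-fromℕ (suc l)))))))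
      ... | no neq = lower₁ i neq , cong p (inject₁-lower₁ i neq)
      shift : ∀ i j → suc (toℕ (inject₁ i)) ≡ toℕ (inject₁ j) → suc (toℕ i) ≡ toℕ j
      shift i j eq = trans (cong suc (sym (toℕ-inject₁ i))) (trans eq (toℕ-inject₁ j))
      unshift : ∀ i j → suc (toℕ i) ≡ toℕ j → suc (toℕ (inject₁ i)) ≡ toℕ (inject₁ j)
      unshift i j eq = trans (cong suc (toℕ-inject₁ i)) (trans eq (sym (toℕ-inject₁ j)))

  private
    endpoint-or-interior : ∀ {l} (t : Fin (suc (suc l))) →
      t ≡ zero ⊎ t ≡ fromℕ (suc l) ⊎ ∃ λ (tp : Fin (suc (suc l))) → ∃ λ (tn : Fin (suc (suc l))) → suc (toℕ tp) ≡ toℕ t × suc (toℕ t) ≡ toℕ tn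
    endpoint-or-interior zero = inj₁ refl
    endpoint-or-interior {l} (suc t) with l ℕ.≟ toℕ t
    ... | yes l≡t = inj₂ (inj₁ (cong suc (toℕ-injective (trans (sym l≡t) (sym (toℕ-fromℕ l))))))
    ... | no l≢t  = inj₂ (inj₂ (inject₁ t , suc (suc (lower₁ t l≢t)) , cong ℕ.suc (toℕ-inject₁ t) , cong (ℕ.suc ∘ ℕ.suc) (sym (toℕ-lower₁ t l≢t))))

  TwoNeighboursIn : (Fin N → Set) → Fin N → Set
  TwoNeighboursIn D ρ = ∃ λ y → ∃ λ z → y ≢ z × Adj K ρ y × Adj K ρ z × D y × D z

  path-or-cycle-minus : ∀ {D : Fin N → Set} {ρ} → InducesPathOrCycle K D → D ρ →
    (∀ {y} → D y → y ≡ ρ) ⊎ InducesPath K (λ x → D x × x ≢ ρ) ⊎ TwoNeighboursIn D ρ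
  path-or-cycle-minus (inj₂ (zero , _ , cycle , _)) _ with IsInducedCycle.length≥3 cycle
  ... | ()
  path-or-cycle-minus (inj₂ (suc k , c , cycle , c∈D , D⊆c)) Dρ with D⊆c _ Dρ
  ... | i , refl = inj₂ (inj₂ (c (next i) , c (prev i) , c-next≢c-prev i , adj-next i , adj-prev i , c∈D _ , c∈D _))
    where
    open OnInducedCycle cycle
    open CyclicOrder k using (next; prev)
  path-or-cycle-minus (inj₁ (zero , _ , () , _)) _
  path-or-cycle-minus (inj₁ (suc zero , p , _ , _ , _ , D⊆p , _)) Dρ = inj₁ λ Dy → trans (only (D⊆p _ Dy)) (sym (only (D⊆p _ Dρ)))
    where
    only : ∀ {x} → OnSeq p x → x ≡ p zero
    only (zero , refl) = refl
  path-or-cycle-minus (inj₁ (suc (suc l) , p , _ , p-injective , p∈D , D⊆p , adj⇒consecutive , consecutive⇒adj)) Dρ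
    with D⊆p _ Dρ
  ... | t , refl with endpoint-or-interior t
  ...   | inj₁ refl        = inj₂ (inj₁ (drop-first p-injective p∈D D⊆p adj⇒consecutive consecutive⇒adj))
  ...   | inj₂ (inj₁ refl) = inj₂ (inj₁ (drop-last p-injective p∈D D⊆p adj⇒consecutive consecutive⇒adj))
  ...   | inj₂ (inj₂ (tp , tn , tp→t , t→tn)) =
    inj₂ (inj₂ (p tp , p tn , (λ eq → <-irrefl (cong toℕ (p-injective eq)) (<-trans (subst (toℕ tp ℕ.<_) tp→t (n<1+n _)) (subst (_ ℕ.<_) t→tn (n<1+n _)))) ,
                 consecutive⇒adj t tp (inj₂ tp→t) , consecutive⇒adj t tn (inj₁ t→tn) , p∈D tp , p∈D tn))

module TwoFactor where

  open import Data.Nat using (_<?_)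
  import Data.Nat as ℕ
  open import Data.Nat.Properties using (+-cancelˡ-≡; *-cancelˡ-≡; +-identityʳ; <-irrefl; <-≤-trans; <-trans; ≤-<-trans; ≮⇒≥; m∸n+n≡m; m≤n+m; +-monoˡ-≤; <⇒≤)
  open import Data.Fin.Properties using (any?)
  open import Relation.Nullary.Decidable using (_×-dec_; _⊎-dec_)

  open Counting

  Deg3On? : ∀ {N k} (K : Graph N) (c : Fin k → Fin N) → Decidable (Deg3On K c)
  Deg3On? K c x = onSeq? c x ×-dec (deg K x ℕ.≟ 3)

  Deg2On? : ∀ {N k} (K : Graph N) (c : Fin k → Fin N) → Decidable (Deg2On K c)
  Deg2On? K c x = onSeq? c x ×-dec (deg K x ℕ.≟ 2)

  #Deg3On : ∀ {N k} → Graph N → (Fin k → Fin N) → ℕ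
  #Deg3On K c = count (Deg3On? K c)

  #Deg2On : ∀ {N k} → Graph N → (Fin k → Fin N) → ℕ
  #Deg2On K c = count (Deg2On? K c)

  #deg3 : ∀ {N} → Graph N → ℕ
  #deg3 K = count (λ x → deg K x ℕ.≟ 3)

  PermTwoFactor-swap : ∀ {m} {K : Graph (2 * m)} {c c′ : Fin m → Fin (2 * m)} → PermTwoFactor K c c′ → PermTwoFactor K c′ c
  PermTwoFactor-swap F = record
    { cycle₁ = cycle₂ ; cycle₂ = cycle₁
    ; disjoint = λ i j eq → disjoint j i (sym eq)
    ; covering = λ x → Data.Sum.swap (covering x) }
    where open PermTwoFactor F

  module PermTwoFactorFacts {n : ℕ} (K : Graph (2 * suc n)) (K-sym : ∀ x y → K x y ≡ K y x) (subcubic : ∀ x → deg K x ≤ 3)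
    {c c′ : Fin (suc n) → Fin (2 * suc n)} (F : PermTwoFactor K c c′) where

    open PermTwoFactor F
    open SymmetricGraph K K-sym
    open CyclicOrder n using (next; prev)
    private
      module C  = OnInducedCycle cycle₁
      module C′ = OnInducedCycle cycle₂

    on-c⇒not-on-c′ : ∀ {x} → OnSeq c x → ¬ OnSeq c′ x
    on-c⇒not-on-c′ (i , refl) (j , c′j≡ci) = disjoint i j (sym c′j≡ci)

    on-c′⇒not-on-c : ∀ {x} → OnSeq c′ x → ¬ OnSeq c x
    on-c′⇒not-on-c on-c′ on-c = on-c⇒not-on-c′ on-c on-c′

    deg≡2⊎deg≡3 : ∀ x → deg K x ≡ 2 ⊎ deg K x ≡ 3
    deg≡2⊎deg≡3 x with covering x
    ... | inj₁ (i , refl) = C.deg≡2⊎deg≡3 subcubic i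
    ... | inj₂ (i , refl) = C′.deg≡2⊎deg≡3 subcubic i

    -- Rungs pair off the degree-3 vertices of c with those of c′, so both cycles carry equally many of them.
    Rung : Fin (2 * suc n) → Fin (2 * suc n) → Set
    Rung x y = Adj K x y × ((OnSeq c x × OnSeq c′ y) ⊎ (OnSeq c′ x × OnSeq c y))

    Rung? : ∀ x → Decidable (Rung x)
    Rung? x y = T? (K x y) ×-dec ((onSeq? c x ×-dec onSeq? c′ y) ⊎-dec (onSeq? c′ x ×-dec onSeq? c y))

    rung-sym : ∀ {x y} → Rung x y → Rung y x
    rung-sym (a , sides) = adj-sym a , Data.Sum.swap (Data.Sum.map Data.Product.swap Data.Product.swap sides)

    rung-unique : ∀ {x y z} → Rung x y → Rung x z → y ≡ z
    rung-unique (xy , inj₁ ((i , refl) , y-on-c′)) (xz , inj₁ (_ , z-on-c′)) =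
      C.off-cycle-neighbour-unique subcubic xy xz (off y-on-c′) (off y-on-c′) (off z-on-c′) (off z-on-c′)
      where
      off : ∀ {y k} → OnSeq c′ y → y ≢ c k
      off y-on-c′ refl = on-c′⇒not-on-c y-on-c′ (_ , refl)
    rung-unique (xy , inj₂ ((i , refl) , y-on-c)) (xz , inj₂ (_ , z-on-c)) =
      C′.off-cycle-neighbour-unique subcubic xy xz (off y-on-c) (off y-on-c) (off z-on-c) (off z-on-c)
      where
      off : ∀ {y k} → OnSeq c y → y ≢ c′ k
      off y-on-c refl = on-c⇒not-on-c′ y-on-c (_ , refl)
    rung-unique (_ , inj₁ (x-on-c , _)) (_ , inj₂ (x-on-c′ , _)) = ⊥-elim (on-c⇒not-on-c′ x-on-c x-on-c′)
    rung-unique (_ , inj₂ (x-on-c′ , _)) (_ , inj₁ (x-on-c , _)) = ⊥-elim (on-c⇒not-on-c′ x-on-c x-on-c′)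

    deg≡2⇒no-rung : ∀ {x y} → deg K x ≡ 2 → ¬ Rung x y
    deg≡2⇒no-rung deg≡2 (a , inj₁ (x-on-c , y-on-c′)) = on-c′⇒not-on-c y-on-c′ (C.deg≡2⇒neighbours-on-cycle x-on-c deg≡2 a)
    deg≡2⇒no-rung deg≡2 (a , inj₂ (x-on-c′ , y-on-c)) = on-c⇒not-on-c′ y-on-c (C′.deg≡2⇒neighbours-on-cycle x-on-c′ deg≡2 a)

    off-c-neighbour⇒on-c′ : ∀ {i y} → Adj K (c i) y → y ≢ c (next i) → y ≢ c (prev i) → OnSeq c′ y
    off-c-neighbour⇒on-c′ {y = y} a y≢next y≢prev with covering y
    ... | inj₂ y-on-c′ = y-on-c′
    ... | inj₁ (j , refl) with C.adj⇒next⊎prev a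
    ...   | inj₁ refl = ⊥-elim (y≢next refl)
    ...   | inj₂ refl = ⊥-elim (y≢prev refl)

    off-c′-neighbour⇒on-c : ∀ {i y} → Adj K (c′ i) y → y ≢ c′ (next i) → y ≢ c′ (prev i) → OnSeq c y
    off-c′-neighbour⇒on-c {y = y} a y≢next y≢prev with covering y
    ... | inj₁ y-on-c = y-on-c
    ... | inj₂ (j , refl) with C′.adj⇒next⊎prev a
    ...   | inj₁ refl = ⊥-elim (y≢next refl)
    ...   | inj₂ refl = ⊥-elim (y≢prev refl)

    deg≡3⇒rung : ∀ {x} → deg K x ≡ 3 → ∃ (Rung x)
    deg≡3⇒rung {x} deg≡3 with covering x
    ... | inj₁ (i , refl) = let (y , a , y≢next , y≢prev) = C.deg≡3⇒off-cycle-neighbour deg≡3 in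
                            y , a , inj₁ ((i , refl) , off-c-neighbour⇒on-c′ a y≢next y≢prev)
    ... | inj₂ (i , refl) = let (y , a , y≢next , y≢prev) = C′.deg≡3⇒off-cycle-neighbour deg≡3 in
                            y , a , inj₂ ((i , refl) , off-c′-neighbour⇒on-c a y≢next y≢prev)

    rung⇒deg≡3 : ∀ {x y} → Rung x y → deg K x ≡ 3
    rung⇒deg≡3 {x} r with deg≡2⊎deg≡3 x
    ... | inj₁ deg≡2 = ⊥-elim (deg≡2⇒no-rung deg≡2 r)
    ... | inj₂ deg≡3 = deg≡3

    partner : Fin (2 * suc n) → Fin (2 * suc n)
    partner x with any? (Rung? x)
    ... | yes (y , _) = y
    ... | no _        = x

    rung⇒partner : ∀ {x y} → Rung x y → partner x ≡ y
    rung⇒partner {x} r with any? (Rung? x)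
    ... | yes (_ , r′) = rung-unique r′ r
    ... | no none      = ⊥-elim (none (_ , r))

    no-rung⇒partner : ∀ {x} → (∀ {y} → ¬ Rung x y) → partner x ≡ x
    no-rung⇒partner {x} none with any? (Rung? x)
    ... | yes (_ , r) = ⊥-elim (none r)
    ... | no _        = refl

    partner-involutive : ∀ x → partner (partner x) ≡ x
    partner-involutive x = Data.Sum.[ fixed , swapped ]′ (deg≡2⊎deg≡3 x)
      where
      fixed : deg K x ≡ 2 → partner (partner x) ≡ x
      fixed deg≡2 = let x-fixed = no-rung⇒partner (deg≡2⇒no-rung deg≡2) in trans (cong partner x-fixed) x-fixed
      swapped : deg K x ≡ 3 → partner (partner x) ≡ x
      swapped deg≡3 = let (y , r) = deg≡3⇒rung deg≡3 in trans (cong partner (rung⇒partner r)) (rung⇒partner (rung-sym r))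

    #Deg3On-c≡c′ : #Deg3On K c ≡ #Deg3On K c′
    #Deg3On-c≡c′ = count-involution (Deg3On? K c) (Deg3On? K c′) partner partner-involutive to from
      where
      to : ∀ {x} → Deg3On K c x → Deg3On K c′ (partner x)
      to (x-on-c , deg≡3) with deg≡3⇒rung deg≡3
      ... | _ , r@(_ , inj₁ (_ , y-on-c′)) = subst (Deg3On K c′) (sym (rung⇒partner r)) (y-on-c′ , rung⇒deg≡3 (rung-sym r))
      ... | _ , (_ , inj₂ (x-on-c′ , _)) = ⊥-elim (on-c⇒not-on-c′ x-on-c x-on-c′)
      from : ∀ {x} → Deg3On K c′ (partner x) → Deg3On K c x
      from {x} (partner-on-c′ , deg≡3) with deg≡2⊎deg≡3 x
      ... | inj₁ deg≡2 with trans (sym deg≡2) (trans (cong (deg K) (sym (no-rung⇒partner (deg≡2⇒no-rung deg≡2)))) deg≡3)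
      ...   | ()
      from {x} (partner-on-c′ , _) | inj₂ deg≡3 with deg≡3⇒rung deg≡3
      ...   | _ , (_ , inj₁ (x-on-c , _)) = x-on-c , deg≡3
      ...   | _ , r@(_ , inj₂ (_ , y-on-c)) = ⊥-elim (on-c⇒not-on-c′ (subst (OnSeq c) (sym (rung⇒partner r)) y-on-c) partner-on-c′)

    #Deg3On+#Deg2On : #Deg3On K c + #Deg2On K c ≡ suc n
    #Deg3On+#Deg2On =
      trans (sym (count-partition (onSeq? c) (Deg3On? K c) (Deg2On? K c) split proj₁ proj₁ (λ (_ , deg≡3) (_ , deg≡2) → deg≡3⇒deg≢2 deg≡3 deg≡2)))
            (count-image c (IsInducedCycle.injective cycle₁))
      where
      split : ∀ {x} → OnSeq c x → Deg3On K c x ⊎ Deg2On K c x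
      split {x} on-c with deg≡2⊎deg≡3 x
      ... | inj₁ deg≡2 = inj₂ (on-c , deg≡2)
      ... | inj₂ deg≡3 = inj₁ (on-c , deg≡3)

    #deg3≡#Deg3On+#Deg3On : #deg3 K ≡ #Deg3On K c + #Deg3On K c′
    #deg3≡#Deg3On+#Deg3On = count-partition (λ x → deg K x ℕ.≟ 3) (Deg3On? K c) (Deg3On? K c′) split proj₂ proj₂
                              (λ (on-c , _) (on-c′ , _) → on-c⇒not-on-c′ on-c on-c′)
      where
      split : ∀ {x} → deg K x ≡ 3 → Deg3On K c x ⊎ Deg3On K c′ x
      split {x} deg≡3 with covering x
      ... | inj₁ on-c  = inj₁ (on-c , deg≡3)
      ... | inj₂ on-c′ = inj₂ (on-c′ , deg≡3)

    2*#Deg3On≡#deg3 : 2 * #Deg3On K c ≡ #deg3 K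
    2*#Deg3On≡#deg3 = trans (cong (#Deg3On K c +_) (trans (+-identityʳ _) #Deg3On-c≡c′)) (sym #deg3≡#Deg3On+#Deg3On)

  module _ {n : ℕ} {K : Graph (2 * suc n)} (K-sym : ∀ x y → K x y ≡ K y x) (subcubic : ∀ x → deg K x ≤ 3)
    {c c′ d d′ : Fin (suc n) → Fin (2 * suc n)} (F : PermTwoFactor K c c′) (D : PermTwoFactor K d d′) where

    private
      module F = PermTwoFactorFacts K K-sym subcubic F
      module D = PermTwoFactorFacts K K-sym subcubic D

    same-#Deg3On : #Deg3On K d ≡ #Deg3On K c
    same-#Deg3On = *-cancelˡ-≡ _ _ 2 (trans D.2*#Deg3On≡#deg3 (sym F.2*#Deg3On≡#deg3))

    same-#Deg2On : #Deg2On K d ≡ #Deg2On K c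
    same-#Deg2On = +-cancelˡ-≡ (#Deg3On K c) _ _
      (trans (cong (_+ #Deg2On K d) (sym same-#Deg3On)) (trans D.#Deg3On+#Deg2On (sym F.#Deg3On+#Deg2On)))

  module _ {n} {K : Graph (2 * suc n)} (K-sym : ∀ x y → K x y ≡ K y x) (subcubic : ∀ x → deg K x ≤ 3)
    {d : Fin (suc n) → Fin (2 * suc n)} (d-cycle : IsInducedCycle K d) (consecutive : InducesPathOrCycle K (Deg3On K d)) where

    private
      open SymmetricGraph K K-sym
      open CyclicOrder n
      module dK = OnInducedCycle d-cycle
      open Arc (dK.path-or-cycle-arc proj₁ consecutive)

      beyond-arc-deg2 : ∀ {j} → size ≤ j → j < suc n → deg K (d (advance j start)) ≡ 2
      beyond-arc-deg2 {j} size≤j j<M with dK.deg≡2⊎deg≡3 subcubic (advance j start)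
      ... | inj₁ deg≡2 = deg≡2
      ... | inj₂ deg≡3 with position ((_ , refl) , deg≡3)
      ...   | j′ , j′<size , eq = ⊥-elim (<-irrefl refl (<-≤-trans (subst (_< size) j′≡j j′<size) size≤j))
        where
        j′≡j : j′ ≡ j
        j′≡j = advance-injective start (<-trans j′<size (≤-<-trans size≤j j<M)) j<M eq

      deg2-index : ∀ {i} → deg K (d i) ≡ 2 → ∃ λ j → size ≤ j × j < suc n × advance j start ≡ i
      deg2-index {i} deg≡2 with advance-surjective start i
      ... | j , j<M , refl = j , ≮⇒≥ (λ j<size → deg≡3⇒deg≢2 (proj₂ (member j<size)) deg≡2) , j<M , refl

      -- From the first position after the arc, d runs through degree-2 vertices only, so it stays on any induced cycle it is on.
      beyond-arc-on : ∀ {C : Fin (suc n) → Fin (2 * suc n)} → IsInducedCycle K C → OnSeq C (d (advance size start)) → ∀ {x} → Deg2On K d x → OnSeq C x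
      beyond-arc-on {C} C-cycle first-on-C ((i , refl) , deg≡2) with deg2-index deg≡2
      ... | j , size≤j , j<M , refl =
        subst (OnSeq C) (cong d (trans (advance-+ (j ∸ size) size start) (cong (λ k → advance k start) (m∸n+n≡m size≤j))))
          (dK.spread-forwards (OnSeq C) (OnInducedCycle.deg≡2⇒neighbours-on-cycle C-cycle) (advance size start) (j ∸ size) first-on-C
            λ k k<j-size → subst (λ i → deg K (d i) ≡ 2) (sym (advance-+ k size start))
              (beyond-arc-deg2 (m≤n+m size k) (≤-<-trans (subst (k + size ≤_) (m∸n+n≡m size≤j) (+-monoˡ-≤ size (<⇒≤ k<j-size))) j<M)))

    deg2-on-one-cycle : ∀ {c c′ : Fin (suc n) → Fin (2 * suc n)} → PermTwoFactor K c c′ → (∀ {x} → Deg2On K d x → OnSeq c x) ⊎ (∀ {x} → Deg2On K d x → OnSeq c′ x)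
    deg2-on-one-cycle F with size <? suc n
    ... | no size≮M = inj₁ λ { ((i , refl) , deg≡2) → let (j , size≤j , j<M , _) = deg2-index deg≡2 in ⊥-elim (size≮M (≤-<-trans size≤j j<M)) }
    ... | yes size<M with PermTwoFactor.covering F (d (advance size start))
    ...   | inj₁ first-on-c  = inj₁ (beyond-arc-on (PermTwoFactor.cycle₁ F) first-on-c)
    ...   | inj₂ first-on-c′ = inj₂ (beyond-arc-on (PermTwoFactor.cycle₂ F) first-on-c′)

module EdgeAddition where

  open import Data.Fin using (_≟_)
  open import Data.Bool using (_∧_)
  open import Data.Bool.Properties using (T-∨)
  open import Function using (_⇔_; mk⇔; Equivalence)
  open import Relation.Nullary using (does)
  open import Relation.Nullary.Decidable using (does-⇔)

  open Counting

  module _ {N : ℕ} where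

    JoinedBy : Fin N → Fin N → Fin N → Fin N → Set
    JoinedBy u v x y = (x ≡ u × y ≡ v) ⊎ (x ≡ v × y ≡ u)

    AddsEdge : Graph N → Graph N → Fin N → Fin N → Set
    AddsEdge G H u v = ∀ {x y} → Adj H x y ⇔ (Adj G x y ⊎ JoinedBy u v x y)

    addEdge-adds : (G : Graph N) (u v : Fin N) → AddsEdge G (addEdge G u v) u v
    addEdge-adds G u v {x} {y} = mk⇔ to from
      where
      pair : ∀ {a b} → T (does (x ≟ a) ∧ does (y ≟ b)) → x ≡ a × y ≡ b
      pair {a} {b} t with x ≟ a | y ≟ b
      ... | yes x≡a | yes y≡b = x≡a , y≡b
      pair′ : ∀ {a b} → x ≡ a × y ≡ b → T (does (x ≟ a) ∧ does (y ≟ b))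
      pair′ {a} {b} (x≡a , y≡b) with x ≟ a | y ≟ b
      ... | yes _  | yes _  = _
      ... | no x≢a | _      = x≢a x≡a
      ... | yes _  | no y≢b = y≢b y≡b
      to : Adj (addEdge G u v) x y → Adj G x y ⊎ JoinedBy u v x y
      to t = Data.Sum.map₂ (Data.Sum.map pair pair ∘ Equivalence.to T-∨) (Equivalence.to T-∨ t)
      from : Adj G x y ⊎ JoinedBy u v x y → Adj (addEdge G u v) x y
      from = Equivalence.from T-∨ ∘ Data.Sum.map₂ (Equivalence.from T-∨ ∘ Data.Sum.map pair′ pair′)

    TwoDeg2Neighbours : Graph N → Fin N → Fin N → Set
    TwoDeg2Neighbours H u v = ∃ λ x → ∃ λ y → x ≢ y
      × (Adj H u x ⊎ Adj H v x) × (Adj H u y ⊎ Adj H v y) × deg H x ≡ 2 × deg H y ≡ 2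

    TwoDeg2Neighbours-swap : ∀ {H u v} → TwoDeg2Neighbours H u v → TwoDeg2Neighbours H v u
    TwoDeg2Neighbours-swap (x , y , x≢y , x-adj , y-adj , x-deg2 , y-deg2) =
      x , y , x≢y , Data.Sum.swap x-adj , Data.Sum.swap y-adj , x-deg2 , y-deg2

    AddsEdge-swap : ∀ {G H u v} → AddsEdge G H u v → AddsEdge G H v u
    AddsEdge-swap adds = mk⇔ (Data.Sum.map₂ Data.Sum.swap ∘ Equivalence.to adds) (Equivalence.from adds ∘ Data.Sum.map₂ Data.Sum.swap)

  module AddedEdge {N : ℕ} {G H : Graph N} {u v : Fin N} (G-sym : ∀ x y → G x y ≡ G y x)
    (adds : AddsEdge G H u v) (u≢v : u ≢ v) (¬uv : ¬ Adj G u v) where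

    G⊆H : ∀ {x y} → Adj G x y → Adj H x y
    G⊆H = Equivalence.from adds ∘ inj₁

    H⇒G⊎uv : ∀ {x y} → Adj H x y → Adj G x y ⊎ JoinedBy u v x y
    H⇒G⊎uv = Equivalence.to adds

    adj-uv : Adj H u v
    adj-uv = Equivalence.from adds (inj₂ (inj₁ (refl , refl)))

    H-sym : ∀ x y → H x y ≡ H y x
    H-sym x y = does-⇔ (mk⇔ flip flip) (T? (H x y)) (T? (H y x))
      where
      flip : ∀ {x y} → Adj H x y → Adj H y x
      flip {x} {y} = Equivalence.from adds
                   ∘ Data.Sum.map (subst T (G-sym x y)) (Data.Sum.swap ∘ Data.Sum.map Data.Product.swap Data.Product.swap)
                   ∘ H⇒G⊎uv

    deg-unchanged : ∀ {x} → x ≢ u → x ≢ v → deg H x ≡ deg G x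
    deg-unchanged {x} x≢u x≢v =
      trans (deg≡count H x) (trans (count-cong (λ y → T? (H x y)) (λ y → T? (G x y)) H⇒G G⊆H) (sym (deg≡count G x)))
      where
      H⇒G : ∀ {y} → Adj H x y → Adj G x y
      H⇒G a with H⇒G⊎uv a
      ... | inj₁ g = g
      ... | inj₂ (inj₁ (x≡u , _)) = ⊥-elim (x≢u x≡u)
      ... | inj₂ (inj₂ (x≡v , _)) = ⊥-elim (x≢v x≡v)

    joined⇒¬adj : ∀ {x y} → JoinedBy u v x y → ¬ Adj G x y
    joined⇒¬adj (inj₁ (refl , refl)) = ¬uv
    joined⇒¬adj (inj₂ (refl , refl)) = ¬uv ∘ subst T (G-sym v u)

    deg-endpoint : ∀ {x y} → JoinedBy u v x y → deg H x ≡ suc (deg G x)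
    deg-endpoint {x} {y} xy =
      trans (deg≡count H x) (trans (count-remove (λ z → T? (H x z)) (Equivalence.from adds (inj₂ xy)))
        (cong suc (trans (count-cong _ (λ z → T? (G x z)) (H∖y⇒G xy) G⇒H∖y) (sym (deg≡count G x)))))
      where
      H∖y⇒G : ∀ {z} → JoinedBy u v x y → Adj H x z × y ≢ z → Adj G x z
      H∖y⇒G joined (a , y≢z) with H⇒G⊎uv a | joined
      ... | inj₁ g                 | _               = g
      ... | inj₂ (inj₁ (_ , refl)) | inj₁ (_ , refl) = ⊥-elim (y≢z refl)
      ... | inj₂ (inj₂ (_ , refl)) | inj₂ (_ , refl) = ⊥-elim (y≢z refl)
      ... | inj₂ (inj₁ (refl , _)) | inj₂ (x≡v , _)  = ⊥-elim (u≢v x≡v)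
      ... | inj₂ (inj₂ (refl , _)) | inj₁ (x≡u , _)  = ⊥-elim (u≢v (sym x≡u))
      G⇒H∖y : ∀ {z} → Adj G x z → Adj H x z × y ≢ z
      G⇒H∖y g = G⊆H g , λ { refl → joined⇒¬adj xy g }

    module _ {k} {c : Fin k → Fin N} (not-both : ¬ (OnSeq c u × OnSeq c v)) where

      private
        H⇒G : ∀ {i j} → Adj H (c i) (c j) → Adj G (c i) (c j)
        H⇒G {i} {j} a with H⇒G⊎uv a
        ... | inj₁ g = g
        ... | inj₂ (inj₁ (ci≡u , cj≡v)) = ⊥-elim (not-both ((i , ci≡u) , (j , cj≡v)))
        ... | inj₂ (inj₂ (ci≡v , cj≡u)) = ⊥-elim (not-both ((j , cj≡u) , (i , ci≡v)))

      lift-cycle : IsInducedCycle G c → IsInducedCycle H c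
      lift-cycle cycle = record
        { length≥3 = length≥3 ; injective = injective
        ; edges = λ i j i→j → G⊆H (edges i j i→j)
        ; chordless = λ i j a → chordless i j (H⇒G a) }
        where open IsInducedCycle cycle

      lower-cycle : IsInducedCycle H c → IsInducedCycle G c
      lower-cycle cycle = record
        { length≥3 = length≥3 ; injective = injective
        ; edges = λ i j i→j → H⇒G (edges i j i→j)
        ; chordless = λ i j g → chordless i j (G⊆H g) }
        where open IsInducedCycle cycle

open EdgeAddition

-- The eligible pair with u ∈ S(a): u = a α is adjacent on a to the degree-3 vertex a β, and v = b γ has degree 2.
module EligibleEdge {n : ℕ} {G H : Graph (2 * suc n)} (G-sym : ∀ x y → G x y ≡ G y x) (G-subcubic : ∀ x → deg G x ≤ 3)
  {u v : Fin (2 * suc n)} (adds : AddsEdge G H u v) (¬uv : ¬ Adj G u v)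
  {a b : Fin (suc n) → Fin (2 * suc n)} (F : PermTwoFactor G a b)
  (deg3-path : InducesPath G (Deg3On G a)) (deg-Gu : deg G u ≡ 2)
  {α β : Fin (suc n)} (aα≡u : a α ≡ u) (αβ : CycAdj (suc n) α β) (deg-Gp : deg G (a β) ≡ 3)
  {γ : Fin (suc n)} (bγ≡v : b γ ≡ v) (deg-Gv : deg G v ≡ 2)
  (two-deg2 : TwoDeg2Neighbours H u v)
  where

  open import Data.Nat.Properties hiding (_≟_)
  open import Data.Fin using (_≟_)
  open import Data.Product using (uncurry)

  open Counting
  open TwoFactor
  open CyclicOrder n

  private
    V : Set
    V = Fin (2 * suc n)

    module F = PermTwoFactor F
    module aG = SymmetricGraph.OnInducedCycle G G-sym F.cycle₁
    module bG = SymmetricGraph.OnInducedCycle G G-sym F.cycle₂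

  on-a⇒≢on-b : ∀ {x y} → OnSeq a x → OnSeq b y → x ≢ y
  on-a⇒≢on-b (i , refl) (j , refl) = F.disjoint i j

  u≢v : u ≢ v
  u≢v = on-a⇒≢on-b (α , aα≡u) (γ , bγ≡v)

  open AddedEdge G-sym adds u≢v ¬uv

  deg-Hu : deg H u ≡ 3
  deg-Hu = trans (deg-endpoint (inj₁ (refl , refl))) (cong suc deg-Gu)

  deg-Hv : deg H v ≡ 3
  deg-Hv = trans (deg-endpoint (inj₂ (refl , refl))) (cong suc deg-Gv)

  H-subcubic : ∀ x → deg H x ≤ 3
  H-subcubic x with x ≟ u | x ≟ v
  ... | yes refl | _        = ≤-reflexive deg-Hu
  ... | no _     | yes refl = ≤-reflexive deg-Hv
  ... | no x≢u   | no x≢v   = subst (_≤ 3) (sym (deg-unchanged x≢u x≢v)) (G-subcubic x)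

  F-in-H : PermTwoFactor H a b
  F-in-H = record
    { cycle₁ = lift-cycle (λ (_ , v-on-a) → on-a⇒≢on-b v-on-a (γ , bγ≡v) refl) F.cycle₁
    ; cycle₂ = lift-cycle (λ (u-on-b , _) → on-a⇒≢on-b (α , aα≡u) u-on-b refl) F.cycle₂
    ; disjoint = F.disjoint ; covering = F.covering }

  β-sides : β ≡ next α ⊎ β ≡ prev α
  β-sides = CycAdj⇒next⊎prev αβ

  ω : Fin (suc n)
  ω with β-sides
  ... | inj₁ _ = prev α
  ... | inj₂ _ = next α

  Orientation : Set
  Orientation = (β ≡ next α × ω ≡ prev α) ⊎ (β ≡ prev α × ω ≡ next α)

  orientation : Orientation
  orientation with β-sides
  ... | inj₁ β≡next = inj₁ (β≡next , refl)
  ... | inj₂ β≡prev = inj₂ (β≡prev , refl)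

  neighbours-of-α : ∀ {P : Fin (suc n) → Set} → P β → P ω → P (next α) × P (prev α)
  neighbours-of-α {P} Pβ Pω with orientation
  ... | inj₁ (β≡next , ω≡prev) = subst P β≡next Pβ , subst P ω≡prev Pω
  ... | inj₂ (β≡prev , ω≡next) = subst P ω≡next Pω , subst P β≡prev Pβ

  p w v₁ v₂ : V
  p  = a β
  w  = a ω
  v₁ = b (next γ)
  v₂ = b (prev γ)

  private
    neighbour-of-α : ∀ {i} → i ≡ next α ⊎ i ≡ prev α → Adj G u (a i) × a i ≢ u
    neighbour-of-α (inj₁ refl) = subst (λ x → Adj G x _) aα≡u (aG.adj-next α) , λ eq → aG.c-next≢c α (trans eq (sym aα≡u))
    neighbour-of-α (inj₂ refl) = subst (λ x → Adj G x _) aα≡u (aG.adj-prev α) , λ eq → aG.c-prev≢c α (trans eq (sym aα≡u))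

    ω-sides : ω ≡ next α ⊎ ω ≡ prev α
    ω-sides with orientation
    ... | inj₁ (_ , ω≡prev) = inj₂ ω≡prev
    ... | inj₂ (_ , ω≡next) = inj₁ ω≡next

    neighbour-of-γ : ∀ {i} → i ≡ next γ ⊎ i ≡ prev γ → Adj G v (b i)
    neighbour-of-γ (inj₁ refl) = subst (λ x → Adj G x _) bγ≡v (bG.adj-next γ)
    neighbour-of-γ (inj₂ refl) = subst (λ x → Adj G x _) bγ≡v (bG.adj-prev γ)

  p≢w : p ≢ w
  p≢w with orientation
  ... | inj₁ (β≡next , ω≡prev) = subst₂ (λ i j → a i ≢ a j) (sym β≡next) (sym ω≡prev) (aG.c-next≢c-prev α)
  ... | inj₂ (β≡prev , ω≡next) = subst₂ (λ i j → a i ≢ a j) (sym β≡prev) (sym ω≡next) (aG.c-next≢c-prev α ∘ sym)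

  p≢u : p ≢ u
  p≢u = proj₂ (neighbour-of-α β-sides)

  w≢u : w ≢ u
  w≢u = proj₂ (neighbour-of-α ω-sides)

  p≢v : p ≢ v
  p≢v = on-a⇒≢on-b (β , refl) (γ , bγ≡v)

  w≢v : w ≢ v
  w≢v = on-a⇒≢on-b (ω , refl) (γ , bγ≡v)

  v₁≢v₂ : v₁ ≢ v₂
  v₁≢v₂ = bG.c-next≢c-prev γ

  v₁≢u : v₁ ≢ u
  v₁≢u = on-a⇒≢on-b (α , aα≡u) (_ , refl) ∘ sym

  v₂≢u : v₂ ≢ u
  v₂≢u = on-a⇒≢on-b (α , aα≡u) (_ , refl) ∘ sym

  deg-Hp : deg H p ≡ 3
  deg-Hp = trans (deg-unchanged p≢u p≢v) deg-Gp

  private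
    module SH = SymmetricGraph H H-sym
  open SH using (deg≡3⇒deg≢2)

  adj-up : Adj H u p
  adj-up = G⊆H (proj₁ (neighbour-of-α β-sides))

  adj-uw : Adj H u w
  adj-uw = G⊆H (proj₁ (neighbour-of-α ω-sides))

  neighbours-u : ∀ {y} → Adj H u y → y ≡ p ⊎ y ≡ w ⊎ y ≡ v
  neighbours-u = SH.deg≡3⇒neighbours deg-Hu adj-up adj-uw adj-uv p≢w p≢v w≢v

  neighbours-v : ∀ {y} → Adj H v y → y ≡ v₁ ⊎ y ≡ v₂ ⊎ y ≡ u
  neighbours-v = SH.deg≡3⇒neighbours deg-Hv (G⊆H (neighbour-of-γ (inj₁ refl))) (G⊆H (neighbour-of-γ (inj₂ refl)))
                   (SH.adj-sym adj-uv) v₁≢v₂ v₁≢u v₂≢u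

  private
    deg2-candidate : ∀ {z} → Adj H u z ⊎ Adj H v z → deg H z ≡ 2 → z ≡ w ⊎ z ≡ v₁ ⊎ z ≡ v₂
    deg2-candidate (inj₁ uz) deg≡2 with neighbours-u uz
    ... | inj₁ refl        = ⊥-elim (deg≡3⇒deg≢2 deg-Hp deg≡2)
    ... | inj₂ (inj₁ z≡w)  = inj₁ z≡w
    ... | inj₂ (inj₂ refl) = ⊥-elim (deg≡3⇒deg≢2 deg-Hv deg≡2)
    deg2-candidate (inj₂ vz) deg≡2 with neighbours-v vz
    ... | inj₁ z≡v₁        = inj₂ (inj₁ z≡v₁)
    ... | inj₂ (inj₁ z≡v₂) = inj₂ (inj₂ z≡v₂)
    ... | inj₂ (inj₂ refl) = ⊥-elim (deg≡3⇒deg≢2 deg-Hu deg≡2)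

    -- Two of the three candidates w, v₁, v₂ have degree 2, so no two of them have degree 3.
    two-deg3⇒⊥ : ∀ {s t r} → (∀ {z} → z ≡ w ⊎ z ≡ v₁ ⊎ z ≡ v₂ → z ≡ s ⊎ z ≡ t ⊎ z ≡ r) → deg H s ≡ 3 → deg H t ≡ 3 → ⊥
    two-deg3⇒⊥ {s} {t} {r} rename s-deg3 t-deg3 =
      let (x , y , x≢y , x-adj , y-adj , x-deg2 , y-deg2) = two-deg2 in
      x≢y (trans (is-r x-adj x-deg2) (sym (is-r y-adj y-deg2)))
      where
      is-r : ∀ {z} → Adj H u z ⊎ Adj H v z → deg H z ≡ 2 → z ≡ r
      is-r adj deg≡2 with rename (deg2-candidate adj deg≡2)
      ... | inj₁ refl        = ⊥-elim (deg≡3⇒deg≢2 s-deg3 deg≡2)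
      ... | inj₂ (inj₁ refl) = ⊥-elim (deg≡3⇒deg≢2 t-deg3 deg≡2)
      ... | inj₂ (inj₂ z≡r)  = z≡r

  ¬w,v₁-deg3 : deg H w ≡ 3 → deg H v₁ ≢ 3
  ¬w,v₁-deg3 = two-deg3⇒⊥ (λ z → z)

  ¬v₁,v₂-deg3 : deg H v₁ ≡ 3 → deg H v₂ ≢ 3
  ¬v₁,v₂-deg3 = two-deg3⇒⊥ λ { (inj₁ z≡w) → inj₂ (inj₂ z≡w) ; (inj₂ (inj₁ z≡v₁)) → inj₁ z≡v₁ ; (inj₂ (inj₂ z≡v₂)) → inj₂ (inj₁ z≡v₂) }

  private
    module FH = PermTwoFactorFacts H H-sym H-subcubic F-in-H
    module aH = SH.OnInducedCycle (PermTwoFactor.cycle₁ F-in-H)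

  deg≢3⇒deg≡2 : ∀ {x} → deg H x ≢ 3 → deg H x ≡ 2
  deg≢3⇒deg≡2 {x} deg≢3 with FH.deg≡2⊎deg≡3 x
  ... | inj₁ deg≡2 = deg≡2
  ... | inj₂ deg≡3 = ⊥-elim (deg≢3 deg≡3)

  1≤n : 1 ≤ n
  1≤n = ≤-trans (s≤s z≤n) aG.2≤n

  a-injective : ∀ {i j} → a i ≡ a j → i ≡ j
  a-injective = IsInducedCycle.injective F.cycle₁

  a-advance≢u : ∀ {j} → suc j < suc n → a (advance (suc j) α) ≢ u
  a-advance≢u sj<M eq = advance≢self α sj<M (a-injective (trans eq (sym aα≡u)))

  -- If w had degree 3, the degree-3 vertices of a in G would form a path through both neighbours of u, hence all of a but u.
  w-deg3⇒a-cubic : deg H w ≡ 3 → ∀ {x} → OnSeq a x → deg H x ≡ 3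
  w-deg3⇒a-cubic w-deg3 (i , refl) with i ≟ α
  ... | yes refl = trans (cong (deg H) aα≡u) deg-Hu
  ... | no i≢α   = trans (deg-unchanged (λ aᵢ≡u → i≢α (a-injective (trans aᵢ≡u (sym aα≡u)))) (on-a⇒≢on-b (i , refl) (γ , bγ≡v)))
                         (proj₂ (arc-complement 1≤n arc ¬Aα (proj₁ A-sides) (proj₂ A-sides) i≢α))
    where
    A : Fin (suc n) → Set
    A = Deg3On G a ∘ a
    arc : Arc A
    arc = aG.path-or-cycle-arc proj₁ (inj₁ deg3-path)
    ¬Aα : ¬ A α
    ¬Aα (_ , deg≡3) with trans (sym deg≡3) (trans (cong (deg G) aα≡u) deg-Gu)
    ... | ()
    A-sides : A (next α) × A (prev α)
    A-sides = neighbours-of-α {A} ((β , refl) , deg-Gp) ((ω , refl) , trans (sym (deg-unchanged w≢u w≢v)) w-deg3)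

  w-deg2 : deg H w ≡ 2
  w-deg2 = deg≢3⇒deg≡2 λ w-deg3 → <-irrefl refl (begin-strict
    suc n                ≡⟨ all-deg3 (w-deg3⇒a-cubic w-deg3) ⟨
    #Deg3On H a          ≡⟨ FH.#Deg3On-c≡c′ ⟩
    #Deg3On H b          <⟨ count-strict (Deg3On? H b) (onSeq? b) proj₁ (_ , refl) (λ (_ , v₁-deg3) → ¬w,v₁-deg3 w-deg3 v₁-deg3) ⟩
    count (onSeq? b)     ≡⟨ count-image b (IsInducedCycle.injective F.cycle₂) ⟩
    suc n                ∎)
    where
    open ≤-Reasoning
    all-deg3 : (∀ {x} → OnSeq a x → deg H x ≡ 3) → #Deg3On H a ≡ suc n
    all-deg3 cubic = trans (count-cong (Deg3On? H a) (onSeq? a) proj₁ (λ on-a → on-a , cubic on-a)) (count-image a a-injective)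

  deg3-neighbour-of-u : ∀ {x} → Adj H u x → deg H x ≡ 3 → x ≢ v → x ≡ p
  deg3-neighbour-of-u ux deg≡3 x≢v with neighbours-u ux
  ... | inj₁ x≡p         = x≡p
  ... | inj₂ (inj₁ refl) = ⊥-elim (deg≡3⇒deg≢2 deg≡3 w-deg2)
  ... | inj₂ (inj₂ x≡v)  = ⊥-elim (x≢v x≡v)

  deg3-neighbours-of-v : ∀ {x y} → Adj H v x → Adj H v y → deg H x ≡ 3 → deg H y ≡ 3 → x ≢ u → y ≢ u → x ≡ y
  deg3-neighbours-of-v vx vy x-deg3 y-deg3 x≢u y≢u with neighbours-v vx | neighbours-v vy
  ... | inj₂ (inj₂ x≡u) | _                = ⊥-elim (x≢u x≡u)
  ... | _               | inj₂ (inj₂ y≡u)  = ⊥-elim (y≢u y≡u)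
  ... | inj₁ x≡v₁       | inj₁ y≡v₁        = trans x≡v₁ (sym y≡v₁)
  ... | inj₂ (inj₁ x≡v₂) | inj₂ (inj₁ y≡v₂) = trans x≡v₂ (sym y≡v₂)
  ... | inj₁ refl       | inj₂ (inj₁ refl) = ⊥-elim (¬v₁,v₂-deg3 x-deg3 y-deg3)
  ... | inj₂ (inj₁ refl) | inj₁ refl       = ⊥-elim (¬v₁,v₂-deg3 y-deg3 x-deg3)

  p-on-cycle-through-u : ∀ {c : Fin (suc n) → V} → IsInducedCycle H c → OnSeq c u → ¬ OnSeq c v → OnSeq c p
  p-on-cycle-through-u {c} cycle (j , refl) v∉c with neighbours-u (C.adj-next j) | neighbours-u (C.adj-prev j)
    where module C = SH.OnInducedCycle cycle
  ... | inj₁ next≡p        | _                  = next j , next≡p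
  ... | _                  | inj₁ prev≡p        = prev j , prev≡p
  ... | inj₂ (inj₂ next≡v) | _                  = ⊥-elim (v∉c (next j , next≡v))
  ... | _                  | inj₂ (inj₂ prev≡v) = ⊥-elim (v∉c (prev j , prev≡v))
  ... | inj₂ (inj₁ next≡w) | inj₂ (inj₁ prev≡w) = ⊥-elim (SH.OnInducedCycle.c-next≢c-prev cycle j (trans next≡w (sym prev≡w)))

  -- Entering a − u at its end w and meeting only degree-2 vertices, d cannot leave a − u before its other end p.
  a-interior-deg2⇒p-on-cycle : ∀ {d : Fin (suc n) → V} → IsInducedCycle H d → OnSeq d w →
    (∀ {j} → a j ≢ u → a j ≢ p → deg H (a j) ≡ 2) → OnSeq d p
  a-interior-deg2⇒p-on-cycle {d} cycle w-on-d interior-deg2 with orientation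
  ... | inj₁ (β≡next , ω≡prev) =
    subst (OnSeq d) (cong a (sym β≡next))
      (aH.spread-backwards (OnSeq d) dH.deg≡2⇒neighbours-on-cycle (next α) (n ∸ 1)
        (subst (OnSeq d) (cong a (trans ω≡prev (sym (advance-around 1≤n α)))) w-on-d) interior)
    where
    module dH = SH.OnInducedCycle cycle
    interior : ∀ j → 1 ≤ j → j ≤ n ∸ 1 → deg H (a (advance j (next α))) ≡ 2
    interior j 1≤j j≤n-1 = subst (λ i → deg H (a i) ≡ 2) (sym (advance-next j α))
      (interior-deg2 (a-advance≢u sj<M) λ ≡p → <⇒≢ 1≤j (sym (suc-injective (advance-injective α sj<M (s≤s 1≤n)
        (a-injective (trans ≡p (cong a β≡next)))))))
      where
      sj<M : suc j < suc n
      sj<M = s≤s (subst (suc j ≤_) (sym (+-∸-assoc 1 1≤n)) (s≤s j≤n-1))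
  ... | inj₂ (β≡prev , ω≡next) =
    subst (OnSeq d) (cong a (trans (advance-around 1≤n α) (sym β≡prev)))
      (aH.spread-forwards (OnSeq d) dH.deg≡2⇒neighbours-on-cycle (next α) (n ∸ 1)
        (subst (OnSeq d) (cong a ω≡next) w-on-d) interior)
    where
    module dH = SH.OnInducedCycle cycle
    interior : ∀ j → j < n ∸ 1 → deg H (a (advance j (next α))) ≡ 2
    interior j j<n-1 = subst (λ i → deg H (a i) ≡ 2) (sym (advance-next j α))
      (interior-deg2 (a-advance≢u (<-trans sj<n (n<1+n n))) λ ≡p → <⇒≢ sj<n (advance-injective α (<-trans sj<n (n<1+n n)) (n<1+n n)
        (a-injective (trans ≡p (cong a β≡prev)))))
      where
      sj<n : suc j < n
      sj<n = subst (suc (suc j) ≤_) (sym (+-∸-assoc 1 1≤n)) (s≤s j<n-1)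

  module _ {d d′ : Fin (suc n) → V} (D : PermTwoFactor H d d′) where

    private
      module D = PermTwoFactor D
      module DH = PermTwoFactorFacts H H-sym H-subcubic D
      module dH = SH.OnInducedCycle D.cycle₁
      module d′H = SH.OnInducedCycle D.cycle₂

    module SharedCycle (u-on-d : OnSeq d u) (v-on-d : OnSeq d v) where

      private
        module RU = dH.OtherCycleNeighbour (dH.other-cycle-neighbour u-on-d v-on-d adj-uv)
        module RV = dH.OtherCycleNeighbour (dH.other-cycle-neighbour v-on-d u-on-d (SH.adj-sym adj-uv))

        u∉d′ : ¬ OnSeq d′ u
        u∉d′ = DH.on-c⇒not-on-c′ u-on-d

        v∉d′ : ¬ OnSeq d′ v
        v∉d′ = DH.on-c⇒not-on-c′ v-on-d

        third-neighbour-of-v : ∀ {x} → Adj H v x → x ≢ RV.other → x ≢ u → deg H x ≡ 3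
        third-neighbour-of-v {x} vx x≢r x≢u with D.covering x
        ... | inj₂ x-on-d′ = d′H.off-cycle-neighbour⇒deg≡3 H-subcubic x-on-d′ (SH.adj-sym vx) v∉d′
        ... | inj₁ x-on-d with RV.neighbours-on-cycle vx x-on-d
        ...   | inj₁ x≡r = ⊥-elim (x≢r x≡r)
        ...   | inj₂ x≡u = ⊥-elim (x≢u x≡u)

      rv-deg2-on-b : deg H RV.other ≡ 2 × OnSeq b RV.other
      rv-deg2-on-b with neighbours-v RV.adj-other
      ... | inj₁ rv≡v₁ = subst (λ x → deg H x ≡ 2) (sym rv≡v₁) (deg≢3⇒deg≡2 λ v₁-deg3 → ¬v₁,v₂-deg3 v₁-deg3
                           (third-neighbour-of-v (G⊆H (neighbour-of-γ (inj₂ refl))) (λ v₂≡rv → v₁≢v₂ (sym (trans v₂≡rv rv≡v₁))) v₂≢u)) ,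
                         (next γ , sym rv≡v₁)
      ... | inj₂ (inj₁ rv≡v₂) = subst (λ x → deg H x ≡ 2) (sym rv≡v₂) (deg≢3⇒deg≡2 λ v₂-deg3 → ¬v₁,v₂-deg3
                                  (third-neighbour-of-v (G⊆H (neighbour-of-γ (inj₁ refl))) (λ v₁≡rv → v₁≢v₂ (trans v₁≡rv rv≡v₂)) v₁≢u) v₂-deg3) ,
                                (prev γ , sym rv≡v₂)
      ... | inj₂ (inj₂ rv≡u) = ⊥-elim (RV.other≢y rv≡u)

      ru≡w : RU.other ≡ w
      ru≡w with neighbours-u RU.adj-other
      ... | inj₂ (inj₁ ru≡w) = ru≡w
      ... | inj₂ (inj₂ ru≡v) = ⊥-elim (RU.other≢y ru≡v)
      ... | inj₁ ru≡p with D.covering w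
      ...   | inj₂ w-on-d′ = ⊥-elim (deg≡3⇒deg≢2 (d′H.off-cycle-neighbour⇒deg≡3 H-subcubic w-on-d′ (SH.adj-sym adj-uw) u∉d′) w-deg2)
      ...   | inj₁ w-on-d with RU.neighbours-on-cycle adj-uw w-on-d
      ...     | inj₁ w≡ru = ⊥-elim (p≢w (trans (sym ru≡p) (sym w≡ru)))
      ...     | inj₂ w≡v  = ⊥-elim (w≢v w≡v)

      w-on-d : OnSeq d w
      w-on-d = subst (OnSeq d) ru≡w RU.other-on-cycle

      p∉d : ¬ OnSeq d p
      p∉d p-on-d with RU.neighbours-on-cycle adj-up p-on-d
      ... | inj₁ p≡ru = p≢w (trans p≡ru ru≡w)
      ... | inj₂ p≡v  = p≢v p≡v

      deg3-on-d⊆uv : InducesPathOrCycle H (Deg3On H d) → ∀ {y} → Deg3On H d y → y ≡ u ⊎ y ≡ v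
      deg3-on-d⊆uv consecutive = SH.propagate consecutive spread (u-on-d , deg-Hu) (inj₁ refl)
        where
        spread : ∀ {x y} → Deg3On H d x → Deg3On H d y → Adj H x y → x ≡ u ⊎ x ≡ v → y ≡ u ⊎ y ≡ v
        spread _ (y-on-d , y-deg3) xy (inj₁ refl) with RU.neighbours-on-cycle xy y-on-d
        ... | inj₁ y≡ru = ⊥-elim (deg≡3⇒deg≢2 y-deg3 (subst (λ z → deg H z ≡ 2) (sym (trans y≡ru ru≡w)) w-deg2))
        ... | inj₂ y≡v  = inj₂ y≡v
        spread _ (y-on-d , y-deg3) xy (inj₂ refl) with RV.neighbours-on-cycle xy y-on-d
        ... | inj₁ y≡rv = ⊥-elim (deg≡3⇒deg≢2 y-deg3 (subst (λ z → deg H z ≡ 2) (sym y≡rv) (proj₁ rv-deg2-on-b)))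
        ... | inj₂ y≡u  = inj₁ y≡u

      -- Only u and v have degree 3 on d, so only u and p on a; then d, which contains w, follows a all the way to p.
      ¬consecutive-d : ¬ InducesPathOrCycle H (Deg3On H d)
      ¬consecutive-d consecutive = p∉d (a-interior-deg2⇒p-on-cycle D.cycle₁ w-on-d interior-deg2)
        where
        #Deg3On-a≤2 : #Deg3On H a ≤ 2
        #Deg3On-a≤2 = subst (_≤ 2) (same-#Deg3On H-sym H-subcubic F-in-H D)
          (count≤length (Deg3On? H d) (u ∷ v ∷ []) λ deg3-on-d → case deg3-on-d⊆uv consecutive deg3-on-d of λ
            { (inj₁ y≡u) → here y≡u ; (inj₂ y≡v) → there (here y≡v) })
        interior-deg2 : ∀ {j} → a j ≢ u → a j ≢ p → deg H (a j) ≡ 2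
        interior-deg2 {j} aj≢u aj≢p = deg≢3⇒deg≡2 λ aj-deg3 → <-irrefl refl (≤-trans
          (length≤count (Deg3On? H a) (u ∷ p ∷ a j ∷ [])
            (((p≢u ∘ sym) ∷ (aj≢u ∘ sym) ∷ []) ∷ ((aj≢p ∘ sym) ∷ []) ∷ [] ∷ [])
            (((α , aα≡u) , deg-Hu) ∷ ((β , refl) , deg-Hp) ∷ ((j , refl) , aj-deg3) ∷ []))
          #Deg3On-a≤2)

      -- The degree-2 vertices of d′ would all lie on a or all on b; but w ∈ a and the other d-neighbour of v ∈ b
      -- are degree-2 vertices outside d′, while all three cycles carry equally many degree-2 vertices.
      ¬consecutive-d′ : ¬ InducesPathOrCycle H (Deg3On H d′)
      ¬consecutive-d′ consecutive with deg2-on-one-cycle H-sym H-subcubic D.cycle₂ consecutive F-in-H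
      ... | inj₁ on-a = <-irrefl (same-#Deg2On H-sym H-subcubic F-in-H (PermTwoFactor-swap D))
          (count-strict (Deg2On? H d′) (Deg2On? H a) (λ q → on-a q , proj₂ q) ((ω , refl) , w-deg2)
            λ (w-on-d′ , _) → DH.on-c⇒not-on-c′ w-on-d w-on-d′)
      ... | inj₂ on-b = <-irrefl (trans (same-#Deg2On H-sym H-subcubic F-in-H (PermTwoFactor-swap D))
                                        (sym (same-#Deg2On H-sym H-subcubic F-in-H (PermTwoFactor-swap F-in-H))))
          (count-strict (Deg2On? H d′) (Deg2On? H b) (λ q → on-b q , proj₂ q) (proj₂ rv-deg2-on-b , proj₁ rv-deg2-on-b)
            λ (rv-on-d′ , _) → DH.on-c⇒not-on-c′ RV.other-on-cycle rv-on-d′)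

    u,v-on-different-cycles : InducesPathOrCycle H (Deg3On H d) ⊎ InducesPathOrCycle H (Deg3On H d′) → ¬ (OnSeq d u × OnSeq d v)
    u,v-on-different-cycles (inj₁ consecutive) (u-on-d , v-on-d) = SharedCycle.¬consecutive-d u-on-d v-on-d consecutive
    u,v-on-different-cycles (inj₂ consecutive) (u-on-d , v-on-d) = SharedCycle.¬consecutive-d′ u-on-d v-on-d consecutive

  InducesPath-transport : ∀ {K K′ : Graph (2 * suc n)} {D D′ : V → Set} → (∀ {x} → D x → D′ x) → (∀ {x} → D′ x → D x) →
    (∀ {x y} → D x → D y → Adj K x y → Adj K′ x y) → (∀ {x y} → D x → D y → Adj K′ x y → Adj K x y) →
    InducesPath K D → InducesPath K′ D′
  InducesPath-transport D⇒D′ D′⇒D K⇒K′ K′⇒K (l , p , 1≤l , p-injective , p∈D , D⊆p , adj⇒consecutive , consecutive⇒adj) =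
    l , p , 1≤l , p-injective , D⇒D′ ∘ p∈D , (λ x → D⊆p x ∘ D′⇒D) ,
    (λ i j a → adj⇒consecutive i j (K′⇒K (p∈D i) (p∈D j) a)) , (λ i j i~j → K⇒K′ (p∈D i) (p∈D j) (consecutive⇒adj i j i~j))

  private
    joined-deg3 : ∀ {ρ σ} → JoinedBy u v ρ σ → deg H ρ ≡ 3
    joined-deg3 (inj₁ (refl , _)) = deg-Hu
    joined-deg3 (inj₂ (refl , _)) = deg-Hv

    joined-≢ : ∀ {ρ σ x} → JoinedBy u v ρ σ → x ≢ ρ → x ≢ σ → x ≢ u × x ≢ v
    joined-≢ (inj₁ (refl , refl)) x≢ρ x≢σ = x≢ρ , x≢σ
    joined-≢ (inj₂ (refl , refl)) x≢ρ x≢σ = x≢σ , x≢ρ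

    deg-G≡3⇒≢ : ∀ {ρ σ x} → JoinedBy u v ρ σ → deg G x ≡ 3 → x ≢ ρ
    deg-G≡3⇒≢ (inj₁ (refl , _)) deg≡3 refl = case trans (sym deg≡3) deg-Gu of λ ()
    deg-G≡3⇒≢ (inj₂ (refl , _)) deg≡3 refl = case trans (sym deg≡3) deg-Gv of λ ()

    H⇒G-avoiding : ∀ {ρ σ x y} → JoinedBy u v ρ σ → x ≢ σ → y ≢ σ → Adj H x y → Adj G x y
    H⇒G-avoiding ρσ x≢σ y≢σ a with H⇒G⊎uv a | ρσ
    ... | inj₁ g                    | _                  = g
    ... | inj₂ (inj₁ (refl , refl)) | inj₁ (refl , refl) = ⊥-elim (y≢σ refl)
    ... | inj₂ (inj₁ (refl , refl)) | inj₂ (refl , refl) = ⊥-elim (x≢σ refl)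
    ... | inj₂ (inj₂ (refl , refl)) | inj₁ (refl , refl) = ⊥-elim (x≢σ refl)
    ... | inj₂ (inj₂ (refl , refl)) | inj₂ (refl , refl) = ⊥-elim (y≢σ refl)

  module _ {d d′ : Fin (suc n) → V} (D : PermTwoFactor H d d′) {ρ σ : V} (ρσ : JoinedBy u v ρ σ)
    (ρ-on-d : OnSeq d ρ) (σ-on-d′ : OnSeq d′ σ) where

    private
      module DH = PermTwoFactorFacts H H-sym H-subcubic D

      ≢σ : ∀ {x} → OnSeq d x → x ≢ σ
      ≢σ x-on-d refl = DH.on-c′⇒not-on-c σ-on-d′ x-on-d

      deg3-G⇒H : ∀ {x} → Deg3On G d x → Deg3On H d x × x ≢ ρ
      deg3-G⇒H {x} (x-on-d , deg≡3) = (x-on-d , trans (uncurry deg-unchanged (joined-≢ ρσ x≢ρ (≢σ x-on-d))) deg≡3) , x≢ρ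
        where
        x≢ρ : x ≢ ρ
        x≢ρ = deg-G≡3⇒≢ ρσ deg≡3

      deg3-H⇒G : ∀ {x} → Deg3On H d x × x ≢ ρ → Deg3On G d x
      deg3-H⇒G ((x-on-d , deg≡3) , x≢ρ) = x-on-d , trans (sym (uncurry deg-unchanged (joined-≢ ρσ x≢ρ (≢σ x-on-d)))) deg≡3

    -- The degree-3 vertices of d in G are those in H except ρ; deleting ρ keeps a path unless ρ is interior or alone.
    consecutive-in-G : ¬ SH.TwoNeighboursIn (Deg3On H d) ρ → ¬ (∀ {y} → Deg3On H d y → y ≡ ρ) →
      InducesPathOrCycle H (Deg3On H d) → InducesPathOrCycle G (Deg3On G d)
    consecutive-in-G ¬two ¬alone consecutive with SH.path-or-cycle-minus consecutive (ρ-on-d , joined-deg3 ρσ)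
    ... | inj₁ alone       = ⊥-elim (¬alone alone)
    ... | inj₂ (inj₂ two)  = ⊥-elim (¬two two)
    ... | inj₂ (inj₁ path) = inj₁ (InducesPath-transport deg3-H⇒G deg3-G⇒H
          (λ ((x-on-d , _) , _) ((y-on-d , _) , _) → H⇒G-avoiding ρσ (≢σ x-on-d) (≢σ y-on-d)) (λ _ _ → G⊆H) path)

  module _ {d d′ : Fin (suc n) → V} (D : PermTwoFactor H d d′) where

    private
      module D = PermTwoFactor D
      module DH = PermTwoFactorFacts H H-sym H-subcubic D

    consecutive-in-G-via-u : OnSeq d u → OnSeq d′ v → InducesPathOrCycle H (Deg3On H d) → InducesPathOrCycle G (Deg3On G d)
    consecutive-in-G-via-u u-on-d v-on-d′ = consecutive-in-G D (inj₁ (refl , refl)) u-on-d v-on-d′ ¬two ¬alone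
      where
      v∉d : ¬ OnSeq d v
      v∉d = DH.on-c′⇒not-on-c v-on-d′
      ≢v : ∀ {x} → OnSeq d x → x ≢ v
      ≢v x-on-d refl = v∉d x-on-d
      ¬two : ¬ SH.TwoNeighboursIn (Deg3On H d) u
      ¬two (y , z , y≢z , uy , uz , (y-on-d , y-deg3) , (z-on-d , z-deg3)) =
        y≢z (trans (deg3-neighbour-of-u uy y-deg3 (≢v y-on-d)) (sym (deg3-neighbour-of-u uz z-deg3 (≢v z-on-d))))
      ¬alone : ¬ (∀ {y} → Deg3On H d y → y ≡ u)
      ¬alone alone = p≢u (alone (p-on-cycle-through-u D.cycle₁ u-on-d v∉d , deg-Hp))

    -- Were v the only degree-3 vertex of d, the count on d′, which contains u and p, would be larger.
    consecutive-in-G-via-v : OnSeq d v → OnSeq d′ u → InducesPathOrCycle H (Deg3On H d) → InducesPathOrCycle G (Deg3On G d)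
    consecutive-in-G-via-v v-on-d u-on-d′ = consecutive-in-G D (inj₂ (refl , refl)) v-on-d u-on-d′ ¬two ¬alone
      where
      u∉d : ¬ OnSeq d u
      u∉d = DH.on-c′⇒not-on-c u-on-d′
      ≢u : ∀ {x} → OnSeq d x → x ≢ u
      ≢u x-on-d refl = u∉d x-on-d
      ¬two : ¬ SH.TwoNeighboursIn (Deg3On H d) v
      ¬two (y , z , y≢z , vy , vz , (y-on-d , y-deg3) , (z-on-d , z-deg3)) =
        y≢z (deg3-neighbours-of-v vy vz y-deg3 z-deg3 (≢u y-on-d) (≢u z-on-d))
      ¬alone : ¬ (∀ {y} → Deg3On H d y → y ≡ v)
      ¬alone alone = <-irrefl refl (begin-strict
        1             <⟨ s≤s (s≤s z≤n) ⟩
        2             ≤⟨ length≤count (Deg3On? H d′) (u ∷ p ∷ []) (((p≢u ∘ sym) ∷ []) ∷ [] ∷ [])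
                           ((u-on-d′ , deg-Hu) ∷ (p-on-cycle-through-u D.cycle₂ u-on-d′ (DH.on-c⇒not-on-c′ v-on-d) , deg-Hp) ∷ []) ⟩
        #Deg3On H d′  ≡⟨ DH.#Deg3On-c≡c′ ⟨
        #Deg3On H d   ≤⟨ count≤length (Deg3On? H d) (v ∷ []) (here ∘ alone) ⟩
        1             ∎)
        where open ≤-Reasoning

  consecutive-of-H⇒of-G : ∀ {d₁ d₂} → ConsecPermTwoFactor H d₁ d₂ → ConsecPermTwoFactor G d₁ d₂
  consecutive-of-H⇒of-G {d₁} {d₂} record { perm = D ; consecutive = consecutive } = record
    { perm = record
      { cycle₁ = lower-cycle apart₁ (PermTwoFactor.cycle₁ D) ; cycle₂ = lower-cycle apart₂ (PermTwoFactor.cycle₂ D)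
      ; disjoint = PermTwoFactor.disjoint D ; covering = PermTwoFactor.covering D }
    ; consecutive = consecutive-in-G′ (PermTwoFactor.covering D u) (PermTwoFactor.covering D v) }
    where
    apart₁ : ¬ (OnSeq d₁ u × OnSeq d₁ v)
    apart₁ = u,v-on-different-cycles D consecutive
    apart₂ : ¬ (OnSeq d₂ u × OnSeq d₂ v)
    apart₂ = u,v-on-different-cycles (PermTwoFactor-swap D) (Data.Sum.swap consecutive)
    consecutive-in-G′ : OnSeq d₁ u ⊎ OnSeq d₂ u → OnSeq d₁ v ⊎ OnSeq d₂ v →
      InducesPathOrCycle G (Deg3On G d₁) ⊎ InducesPathOrCycle G (Deg3On G d₂)
    consecutive-in-G′ (inj₁ u-on-d₁) (inj₁ v-on-d₁) = ⊥-elim (apart₁ (u-on-d₁ , v-on-d₁))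
    consecutive-in-G′ (inj₂ u-on-d₂) (inj₂ v-on-d₂) = ⊥-elim (apart₂ (u-on-d₂ , v-on-d₂))
    consecutive-in-G′ (inj₁ u-on-d₁) (inj₂ v-on-d₂) =
      Data.Sum.map (consecutive-in-G-via-u D u-on-d₁ v-on-d₂) (consecutive-in-G-via-v (PermTwoFactor-swap D) v-on-d₂ u-on-d₁) consecutive
    consecutive-in-G′ (inj₂ u-on-d₂) (inj₁ v-on-d₁) =
      Data.Sum.map (consecutive-in-G-via-v D v-on-d₁ u-on-d₂) (consecutive-in-G-via-u (PermTwoFactor-swap D) u-on-d₂ v-on-d₁) consecutive

open TwoFactor using (PermTwoFactor-swap)

eligible-edge : ∀ {n} {G H : Graph (2 * suc n)} → (∀ x y → G x y ≡ G y x) → Subcubic G →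
  ∀ {u v} {a b d₁ d₂ : Fin (suc n) → Fin (2 * suc n)} → AddsEdge G H u v → ¬ Adj G u v →
  PermTwoFactor G a b → InS G a u → Deg2On G b v → TwoDeg2Neighbours H u v →
  ConsecPermTwoFactor H d₁ d₂ → ConsecPermTwoFactor G d₁ d₂
eligible-edge G-sym G-subcubic adds ¬uv F (path , deg-Gu , _ , _ , aα≡u , αβ , (_ , deg-Gp)) ((_ , bγ≡v) , deg-Gv) two-deg2 =
  EligibleEdge.consecutive-of-H⇒of-G G-sym G-subcubic adds ¬uv F path deg-Gu aα≡u αβ deg-Gp bγ≡v deg-Gv two-deg2

proposition1 :
    (m : ℕ) (G : Graph (2 * m)) → IsSimple G → Subcubic G →
    (c₁ c₂ : Fin m → Fin (2 * m)) → ConsecPermTwoFactor G c₁ c₂ →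
    (u v : Fin (2 * m)) → ¬ Adj G u v → Eligible G c₁ c₂ u v →
    (∃ λ x → ∃ λ y → x ≢ y
      × (Adj (addEdge G u v) u x ⊎ Adj (addEdge G u v) v x)
      × (Adj (addEdge G u v) u y ⊎ Adj (addEdge G u v) v y)
      × deg (addEdge G u v) x ≡ 2 × deg (addEdge G u v) y ≡ 2) →
    (d₁ d₂ : Fin m → Fin (2 * m)) →
    ConsecPermTwoFactor (addEdge G u v) d₁ d₂ → ConsecPermTwoFactor G d₁ d₂
proposition1 zero G _ _ c₁ c₂ F =
  case IsInducedCycle.length≥3 (PermTwoFactor.cycle₁ (ConsecPermTwoFactor.perm F)) of λ ()
proposition1 (suc n) G (G-sym , _) G-subcubic c₁ c₂ F u v ¬uv eligible two-deg2 d₁ d₂ = by-cases eligible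
  where
  F₁₂ : PermTwoFactor G c₁ c₂
  F₁₂ = ConsecPermTwoFactor.perm F
  F₂₁ : PermTwoFactor G c₂ c₁
  F₂₁ = PermTwoFactor-swap F₁₂
  adds-uv : AddsEdge G (addEdge G u v) u v
  adds-uv = addEdge-adds G u v
  adds-vu : AddsEdge G (addEdge G u v) v u
  adds-vu = AddsEdge-swap adds-uv
  ¬vu : ¬ Adj G v u
  ¬vu = ¬uv ∘ subst T (G-sym v u)
  two-deg2′ : TwoDeg2Neighbours (addEdge G u v) v u
  two-deg2′ = TwoDeg2Neighbours-swap {H = addEdge G u v} two-deg2
  by-cases : Eligible G c₁ c₂ u v → ConsecPermTwoFactor (addEdge G u v) d₁ d₂ → ConsecPermTwoFactor G d₁ d₂
  by-cases (inj₁ (u∈S , v-deg2))               = eligible-edge G-sym G-subcubic adds-uv ¬uv F₁₂ u∈S v-deg2 two-deg2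
  by-cases (inj₂ (inj₁ (u∈S , v-deg2)))        = eligible-edge G-sym G-subcubic adds-uv ¬uv F₂₁ u∈S v-deg2 two-deg2
  by-cases (inj₂ (inj₂ (inj₁ (v∈S , u-deg2)))) = eligible-edge G-sym G-subcubic adds-vu ¬vu F₁₂ v∈S u-deg2 two-deg2′
  by-cases (inj₂ (inj₂ (inj₂ (v∈S , u-deg2)))) = eligible-edge G-sym G-subcubic adds-vu ¬vu F₂₁ v∈S u-deg2 two-deg2′
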